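{- For $n\geq 0$, $$2^nA_n(x)=\sum_{k=0}^n\binom{n}{k}A_k(x)C_{n-k}^E(x),\qquad B_n(x)=A_n(x)+x\sum_{k=0}^{n-1}\binom{n}{k}A_k(x)C_{n-k}^O(x).$$
   Context: $A_n(x)=\sum_{\pi\in\mathcal{S}_n}x^{{\rm des}_A(\pi)}$ is the Eulerian polynomial ($\mathcal{S}_n$ the symmetric group, ${\rm des}_A(\pi)=\#\{i\in[n-1]:\pi(i)>\pi(i+1)\}$, $A_0=1$), and $B_n(x)=\sum_{\pi\in\mathcal{S}^B_n}x^{{\rm des}_B(\pi)}$, where $\mathcal{S}^B_n$ is the set of signed permutations of $\pm[n]$ (with $\pi(-i)=-\pi(i)$) and ${\rm des}_B(\pi)=\#\{i\in\{0,\ldots,n-1\}:\pi(i)>\pi(i+1)\}$ with $\pi(0)=0$; $B_0=1$. For $m\ge1$ let $C_m^+=\{\pi\in\mathcal{S}^B_m:\pi(1)>0\}$, $C_m^-=\{\pi\in\mathcal{S}^B_m:\pi(1)<0\}$, $C_m^E(x)=\sum_{\pi\in C_m^+}x^{{\rm des}_A(\pi)}$, $C_m^O(x)=\sum_{\pi\in C_m^- }x^{{\rm des}_A(\pi)}$ (${\rm des}_A$ of $\pi(1)\cdots\pi(m)$ in the usual integer order), and set $C_0^E(x)=1$. -}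

module Defs where

open import Data.Nat using (ℕ; zero; suc; _+_; _*_; _^_; _∸_)
open import Data.Nat.Combinatorics using (_C_)
open import Data.Integer as ℤ using (ℤ; +_; -_; ∣_∣)
open import Data.List using (List; []; _∷_; map; concatMap; filter; length; upTo; applyUpTo)
open import Data.Nat.ListAction using (sum)
open import Data.List.Relation.Unary.Unique.DecPropositional Data.Nat._≟_ using (Unique; unique?)
open import Data.List.Relation.Unary.All using (All; all?)
open import Data.List.Membership.DecPropositional ℤ._≟_ using (_∈_; _∈?_)
open import Relation.Nullary using (Dec; yes; no; does)
open import Relation.Unary using (Pred; Decidable)
open import Data.Bool using (Bool; true; false; if_then_else_)
open import Relation.Binary.PropositionalEquality using (_≡_)

words : ℕ → List ℤ → List (List ℤ)
words zero    al = [] ∷ []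
words (suc n) al = concatMap (λ a → map (a ∷_) (words n al)) al

pos : ℕ → List ℤ
pos n = applyUpTo (λ i → + suc i) n

signed : ℕ → List ℤ
signed n = pos n Data.List.++ map -_ (pos n)

Sym : ℕ → List (List ℤ)
Sym n = filter (λ w → unique? (map ∣_∣ w)) (words n (pos n))

-- S^B_n : words π(1)…π(n) over ±[n] with distinct absolute values
-- (π(-i) = -π(i) determines the rest)
SymB : ℕ → List (List ℤ)
SymB n = filter (λ w → unique? (map ∣_∣ w)) (words n (signed n))

desA : List ℤ → ℕ
desA []           = 0
desA (a ∷ [])     = 0
desA (a ∷ b ∷ w)  = (if does (b ℤ.<? a) then 1 else 0) + desA (b ∷ w)

desB : List ℤ → ℕ
desB w = desA (+ 0 ∷ w)

firstPos : List ℤ → Bool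
firstPos []      = false
firstPos (a ∷ _) = does (+ 0 ℤ.<? a)

firstNeg : List ℤ → Bool
firstNeg []      = false
firstNeg (a ∷ _) = does (a ℤ.<? + 0)

-- Polynomials with ℕ coefficients, as coefficient sequences
-- (p d = coefficient of x^d); equality is pointwise.

Poly : Set
Poly = ℕ → ℕ

_≈P_ : Poly → Poly → Set
p ≈P q = ∀ d → p d ≡ q d

genPoly : (List ℤ → ℕ) → List (List ℤ) → Poly
genPoly stat ws d = length (filter (λ w → stat w Data.Nat.≟ d) ws)

0P : Poly
0P d = 0

1P : Poly
1P zero    = 1
1P (suc d) = 0

_+P_ : Poly → Poly → Poly
(p +P q) d = p d + q d

_·P_ : ℕ → Poly → Poly
(c ·P p) d = c * p d

xP : Poly → Poly
xP p zero    = 0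
xP p (suc d) = p d

_*P_ : Poly → Poly → Poly
(p *P q) d = sum (map (λ i → p i * q (d ∸ i)) (upTo (suc d)))

ΣP : ℕ → (ℕ → Poly) → Poly
ΣP zero    f = 0P
ΣP (suc m) f = ΣP m f +P f m

A : ℕ → Poly
A n = genPoly desA (Sym n)

B : ℕ → Poly
B n = genPoly desB (SymB n)

CE : ℕ → Poly
CE zero    = 1P
CE (suc m) = genPoly desA (Data.List.filterᵇ firstPos (SymB (suc m)))

-- C^O_m(x) = Σ_{π ∈ S^B_m, π(1) < 0} x^{des_A π}   (m ≥ 1; only used for m ≥ 1)
CO : ℕ → Poly
CO m = genPoly desA (Data.List.filterᵇ firstNeg (SymB m))

-- Cut a signed permutation π(1)…π(n) after its maximal initial run of letters of one sign.
-- The descent polynomial of the arrangements of a set of distinct letters, read after a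
-- predecessor, only depends on the size of the set and on the rank of the predecessor in it, so
-- a run of k letters contributes A_k and the remaining n − k letters, which start with the
-- opposite sign, contribute C^E_{n−k} or C^O_{n−k}; the letters of the run can be chosen in
-- binom(n, k) ways. With negative runs the junction is never a descent, and summing over all
-- 2^n signings of the ordinary permutations gives the first identity. With positive runs,
-- preceded by π(0) = 0, the junction is always a descent, which gives the factor x in the
-- second identity.

module Submission where

open import Defs
open import Level using (0ℓ)
open import Data.Bool using (Bool; true; false; if_then_else_; _∧_; _∨_; not; T; T?)
open import Data.Bool.Properties using (∧-zeroʳ; ∧-identityʳ)
open import Data.Empty using (⊥-elim)
open import Data.Integer as ℤ using (ℤ; -[1+_]; ∣_∣)
import Data.Integer.Properties as ℤ
open import Data.Nat using (ℕ; zero; suc; _+_; _*_; _^_; _∸_; _≤_; _<_; z≤n; s≤s; s≤s⁻¹; _≡ᵇ_; _≤ᵇ_; _<ᵇ_)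
open import Data.Nat.Properties
open import Algebra.Properties.CommutativeSemigroup +-commutativeSemigroup using () renaming (interchange to +-interchange)
open import Data.Nat.Combinatorics using (_C_; k>n⇒nCk≡0; nCk+nC[k+1]≡[n+1]C[k+1]; nCn≡1)
open import Data.Nat.ListAction using (sum)
open import Data.Nat.ListAction.Properties using (sum-↭; sum-++)
open import Data.List using (List; []; _∷_; _++_; map; concatMap; filter; filterᵇ; length; null; upTo; applyUpTo)
open import Data.List.Properties using (map-upTo; length-upTo; map-++; length-map; length-++)
open import Data.List.Membership.Propositional using (_∈_)
open import Data.List.Membership.Propositional.Properties using (∈-map⁺; ∈-map⁻; ∈-++⁺ˡ; ∈-++⁺ʳ; ∈-++⁻)
open import Data.List.Relation.Binary.Permutation.Propositional
  using (_↭_; ↭-refl; ↭-sym; ↭-trans; ↭-prep; ↭-swap; ↭⇒↭ₛ)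
import Data.List.Relation.Binary.Permutation.Propositional.Properties as ↭
open import Data.List.Relation.Binary.Permutation.Propositional.Properties using (↭-length; ∈-resp-↭)
open import Data.List.Relation.Unary.Any using (here; there)
open import Data.List.Relation.Unary.All as All using (All; []; _∷_; all?)
import Data.List.Relation.Unary.All.Properties as All
open import Data.List.Relation.Unary.AllPairs using ([]; _∷_)
open import Data.List.Relation.Unary.Unique.Propositional using (Unique)
import Data.List.Relation.Unary.Unique.Propositional.Properties as Unique
open import Data.List.Relation.Unary.Unique.DecPropositional _≟_ using (unique?)
open import Data.Maybe using (Maybe; just; nothing)
open import Data.Product using (_×_; _,_; proj₁; proj₂; map₁; map₂)
open import Data.Sum using (inj₁; inj₂)
open import Function using (_∘_; id)
open import Relation.Binary using (Setoid)
open import Relation.Binary.PropositionalEquality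
  using (_≡_; _≢_; refl; sym; trans; cong; cong₂; subst; subst₂; setoid; _→-setoid_; module ≡-Reasoning)
open import Relation.Binary.Definitions using (tri<; tri≈; tri>)
open import Relation.Nullary using (¬_; does; yes; no; ¬?)
open import Relation.Nullary.Decidable using (dec-true; dec-false)
open import Relation.Unary using (Pred; Decidable)
import Relation.Binary.Reasoning.Setoid as SetoidReasoning
import Data.List.Relation.Binary.Permutation.Setoid.Properties as ↭ₛ

Poly-setoid : Setoid 0ℓ 0ℓ
Poly-setoid = ℕ →-setoid ℕ

module PolyReasoning = SetoidReasoning Poly-setoid

open Setoid Poly-setoid using () renaming (refl to ≈P-refl; sym to ≈P-sym; trans to ≈P-trans)

+P-cong : {p p′ q q′ : Poly} → p ≈P p′ → q ≈P q′ → (p +P q) ≈P (p′ +P q′)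
+P-cong e f d = cong₂ _+_ (e d) (f d)

+P-congˡ : (p : Poly) {q q′ : Poly} → q ≈P q′ → (p +P q) ≈P (p +P q′)
+P-congˡ p = +P-cong {p} ≈P-refl

+P-congʳ : {p p′ : Poly} (q : Poly) → p ≈P p′ → (p +P q) ≈P (p′ +P q)
+P-congʳ q e = +P-cong e (≈P-refl {q})

+P-comm : (p q : Poly) → (p +P q) ≈P (q +P p)
+P-comm p q d = +-comm (p d) (q d)

+P-assoc : (p q r : Poly) → ((p +P q) +P r) ≈P (p +P (q +P r))
+P-assoc p q r d = +-assoc (p d) (q d) (r d)

+P-identityʳ : (p : Poly) → (p +P 0P) ≈P p
+P-identityʳ p d = +-identityʳ (p d)

+P-interchange : (p q r s : Poly) → ((p +P q) +P (r +P s)) ≈P ((p +P r) +P (q +P s))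
+P-interchange p q r s d = +-interchange (p d) (q d) (r d) (s d)

·P-distribʳ : (a b : ℕ) (p : Poly) → ((a + b) ·P p) ≈P ((a ·P p) +P (b ·P p))
·P-distribʳ a b p d = *-distribʳ-+ (p d) a b

·P-identityˡ : (p : Poly) → (1 ·P p) ≈P p
·P-identityˡ p d = +-identityʳ (p d)

·P-xP : (k : ℕ) (p : Poly) → (k ·P xP p) ≈P xP (k ·P p)
·P-xP k p zero    = *-zeroʳ k
·P-xP k p (suc d) = refl

xIf : Bool → Poly → Poly
xIf true  p = xP p
xIf false p = p

record IsLinear (L : Poly → Poly) : Set where
  field
    ≈-cong : ∀ {p q} → p ≈P q → L p ≈P L q
    0-homo : L 0P ≈P 0P
    +-homo : ∀ p q → L (p +P q) ≈P (L p +P L q)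

open IsLinear

xP-linear : IsLinear xP
xP-linear = record
  { ≈-cong = λ { e zero → refl ; e (suc d) → e d }
  ; 0-homo = λ { zero → refl ; (suc d) → refl }
  ; +-homo = λ { p q zero → refl ; p q (suc d) → refl }
  }

·P-linear : (k : ℕ) → IsLinear (k ·P_)
·P-linear k = record
  { ≈-cong = λ e d → cong (k *_) (e d)
  ; 0-homo = λ d → *-zeroʳ k
  ; +-homo = λ p q d → *-distribˡ-+ k (p d) (q d)
  }

xIf-linear : (b : Bool) → IsLinear (xIf b)
xIf-linear true  = xP-linear
xIf-linear false = record { ≈-cong = id ; 0-homo = ≈P-refl ; +-homo = λ p q → ≈P-refl }

∑ : {X : Set} → List X → (X → Poly) → Poly
∑ []       f = 0P
∑ (x ∷ xs) f = f x +P ∑ xs f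

module _ {X : Set} where

  ∑-cong : (xs : List X) {f g : X → Poly} → (∀ x → f x ≈P g x) → ∑ xs f ≈P ∑ xs g
  ∑-cong []       e d = refl
  ∑-cong (x ∷ xs) e d = cong₂ _+_ (e x d) (∑-cong xs e d)

  ∑-++ : (xs ys : List X) (f : X → Poly) → ∑ (xs ++ ys) f ≈P (∑ xs f +P ∑ ys f)
  ∑-++ []       ys f d = refl
  ∑-++ (x ∷ xs) ys f d = trans (cong (f x d +_) (∑-++ xs ys f d)) (sym (+-assoc (f x d) _ _))

  ∑-+P : (xs : List X) (f g : X → Poly) → ∑ xs (λ x → f x +P g x) ≈P (∑ xs f +P ∑ xs g)
  ∑-+P []       f g d = refl
  ∑-+P (x ∷ xs) f g d =
    trans (cong (f x d + g x d +_) (∑-+P xs f g d)) (+-interchange (f x d) (g x d) _ _)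

  ∑-0P : (xs : List X) → ∑ xs (λ _ → 0P) ≈P 0P
  ∑-0P []       d = refl
  ∑-0P (x ∷ xs) d = ∑-0P xs d

  ∑-linear : {L : Poly → Poly} → IsLinear L → (xs : List X) (f : X → Poly) → L (∑ xs f) ≈P ∑ xs (L ∘ f)
  ∑-linear isL []       f = 0-homo isL
  ∑-linear isL (x ∷ xs) f =
    ≈P-trans (+-homo isL (f x) (∑ xs f)) (+P-congˡ _ (∑-linear isL xs f))

  ∑-const : (xs : List X) (c : Poly) → ∑ xs (λ _ → c) ≈P (length xs ·P c)
  ∑-const []       c d = refl
  ∑-const (x ∷ xs) c d = cong (c d +_) (∑-const xs c d)

  ∑-cong-∈ : (xs : List X) {f g : X → Poly} → (∀ x → x ∈ xs → f x ≈P g x) → ∑ xs f ≈P ∑ xs g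
  ∑-cong-∈ []       e d = refl
  ∑-cong-∈ (x ∷ xs) e d = cong₂ _+_ (e x (here refl) d) (∑-cong-∈ xs (λ y y∈xs → e y (there y∈xs)) d)

  ∑-filter : {P : Pred X 0ℓ} (P? : Decidable P) (xs : List X) (f : X → Poly) →
    ∑ (filter P? xs) f ≈P ∑ xs (λ x → if does (P? x) then f x else 0P)
  ∑-filter P? []       f = ≈P-refl
  ∑-filter P? (x ∷ xs) f with does (P? x)
  ... | true  = +P-congˡ (f x) (∑-filter P? xs f)
  ... | false = ∑-filter P? xs f

  ∑-filterᵇ : (b : X → Bool) (xs : List X) (f : X → Poly) →
    ∑ (filterᵇ b xs) f ≈P ∑ xs (λ x → if b x then f x else 0P)
  ∑-filterᵇ b []       f = ≈P-refl
  ∑-filterᵇ b (x ∷ xs) f with b x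
  ... | true  = +P-congˡ (f x) (∑-filterᵇ b xs f)
  ... | false = ∑-filterᵇ b xs f

∑-map : {X Y : Set} (g : X → Y) (xs : List X) (f : Y → Poly) → ∑ (map g xs) f ≈P ∑ xs (f ∘ g)
∑-map g []       f d = refl
∑-map g (x ∷ xs) f d = cong (f (g x) d +_) (∑-map g xs f d)

∑-concatMap : {X Y : Set} (g : X → List Y) (xs : List X) (f : Y → Poly) →
  ∑ (concatMap g xs) f ≈P ∑ xs (λ x → ∑ (g x) f)
∑-concatMap g []       f d = refl
∑-concatMap g (x ∷ xs) f d =
  trans (∑-++ (g x) (concatMap g xs) f d) (cong (∑ (g x) f d +_) (∑-concatMap g xs f d))

ΣP-cong-< : (m : ℕ) {f g : ℕ → Poly} → (∀ j → j < m → f j ≈P g j) → ΣP m f ≈P ΣP m g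
ΣP-cong-< zero    e = ≈P-refl
ΣP-cong-< (suc m) e = +P-cong (ΣP-cong-< m (λ j j<m → e j (m<n⇒m<1+n j<m))) (e m ≤-refl)

ΣP-cong : (m : ℕ) {f g : ℕ → Poly} → (∀ j → f j ≈P g j) → ΣP m f ≈P ΣP m g
ΣP-cong m e = ΣP-cong-< m (λ j _ → e j)

ΣP-+P : (m : ℕ) (f g : ℕ → Poly) → ΣP m (λ k → f k +P g k) ≈P (ΣP m f +P ΣP m g)
ΣP-+P zero    f g = ≈P-refl
ΣP-+P (suc m) f g =
  ≈P-trans (+P-congʳ (f m +P g m) (ΣP-+P m f g)) (+P-interchange (ΣP m f) (ΣP m g) (f m) (g m))

ΣP-linear : {L : Poly → Poly} → IsLinear L → (m : ℕ) (f : ℕ → Poly) → L (ΣP m f) ≈P ΣP m (L ∘ f)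
ΣP-linear isL zero    f = 0-homo isL
ΣP-linear isL (suc m) f = ≈P-trans (+-homo isL (ΣP m f) (f m)) (+P-congʳ _ (ΣP-linear isL m f))

ΣP-suc : (m : ℕ) (f : ℕ → Poly) → ΣP (suc m) f ≈P (f 0 +P ΣP m (f ∘ suc))
ΣP-suc zero    f = +P-comm 0P (f 0)
ΣP-suc (suc m) f = ≈P-trans (+P-congʳ (f (suc m)) (ΣP-suc m f)) (+P-assoc (f 0) (ΣP m (f ∘ suc)) (f (suc m)))

sumTo : ℕ → (ℕ → ℕ) → ℕ
sumTo zero    f = 0
sumTo (suc n) f = f 0 + sumTo n (f ∘ suc)

sumTo-cong-< : (n : ℕ) {f g : ℕ → ℕ} → (∀ i → i < n → f i ≡ g i) → sumTo n f ≡ sumTo n g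
sumTo-cong-< zero    e = refl
sumTo-cong-< (suc n) e = cong₂ _+_ (e 0 (s≤s z≤n)) (sumTo-cong-< n (λ i i<n → e (suc i) (s≤s i<n)))

sumTo-zero : (n : ℕ) {f : ℕ → ℕ} → (∀ i → i < n → f i ≡ 0) → sumTo n f ≡ 0
sumTo-zero zero    e = refl
sumTo-zero (suc n) e = cong₂ _+_ (e 0 (s≤s z≤n)) (sumTo-zero n (λ i i<n → e (suc i) (s≤s i<n)))

sumTo-+ : (n : ℕ) (f g : ℕ → ℕ) → sumTo n (λ i → f i + g i) ≡ sumTo n f + sumTo n g
sumTo-+ zero    f g = refl
sumTo-+ (suc n) f g =
  trans (cong (f 0 + g 0 +_) (sumTo-+ n (f ∘ suc) (g ∘ suc))) (+-interchange (f 0) (g 0) _ _)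

sumTo-last : (n : ℕ) (f : ℕ → ℕ) → sumTo (suc n) f ≡ sumTo n f + f n
sumTo-last zero    f = +-comm (f 0) 0
sumTo-last (suc n) f = trans (cong (f 0 +_) (sumTo-last n (f ∘ suc))) (sym (+-assoc (f 0) _ _))

*P-sumTo : (p q : Poly) (d : ℕ) → (p *P q) d ≡ sumTo (suc d) (λ i → p i * q (d ∸ i))
*P-sumTo p q d = go id (suc d)
  where
  go : (g : ℕ → ℕ) (n : ℕ) →
    sum (map (λ i → p i * q (d ∸ i)) (applyUpTo g n)) ≡ sumTo n (λ i → p (g i) * q (d ∸ g i))
  go g zero    = refl
  go g (suc n) = cong (p (g 0) * q (d ∸ g 0) +_) (go (g ∘ suc) n)

*P-congˡ : {p p′ : Poly} (q : Poly) → p ≈P p′ → (p *P q) ≈P (p′ *P q)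
*P-congˡ {p} {p′} q e d = begin
  (p *P q) d                               ≡⟨ *P-sumTo p q d ⟩
  sumTo (suc d) (λ i → p i * q (d ∸ i))    ≡⟨ sumTo-cong-< (suc d) (λ i _ → cong (_* q (d ∸ i)) (e i)) ⟩
  sumTo (suc d) (λ i → p′ i * q (d ∸ i))   ≡⟨ sym (*P-sumTo p′ q d) ⟩
  (p′ *P q) d                              ∎
  where open ≡-Reasoning

*P-congʳ : (p : Poly) {q q′ : Poly} → q ≈P q′ → (p *P q) ≈P (p *P q′)
*P-congʳ p {q} {q′} e d = begin
  (p *P q) d                               ≡⟨ *P-sumTo p q d ⟩
  sumTo (suc d) (λ i → p i * q (d ∸ i))    ≡⟨ sumTo-cong-< (suc d) (λ i _ → cong (p i *_) (e (d ∸ i))) ⟩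
  sumTo (suc d) (λ i → p i * q′ (d ∸ i))   ≡⟨ sym (*P-sumTo p q′ d) ⟩
  (p *P q′) d                              ∎
  where open ≡-Reasoning

*P-linearˡ : (q : Poly) → IsLinear (_*P q)
*P-linearˡ q = record { ≈-cong = *P-congˡ q ; 0-homo = zeroˡ ; +-homo = distribʳ }
  where
  zeroˡ : (0P *P q) ≈P 0P
  zeroˡ d = trans (*P-sumTo 0P q d) (sumTo-zero (suc d) (λ i _ → refl))
  distribʳ : ∀ p r → ((p +P r) *P q) ≈P ((p *P q) +P (r *P q))
  distribʳ p r d = begin
    ((p +P r) *P q) d
      ≡⟨ *P-sumTo (p +P r) q d ⟩
    sumTo (suc d) (λ i → (p i + r i) * q (d ∸ i))
      ≡⟨ sumTo-cong-< (suc d) (λ i _ → *-distribʳ-+ (q (d ∸ i)) (p i) (r i)) ⟩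
    sumTo (suc d) (λ i → p i * q (d ∸ i) + r i * q (d ∸ i))
      ≡⟨ sumTo-+ (suc d) (λ i → p i * q (d ∸ i)) (λ i → r i * q (d ∸ i)) ⟩
    sumTo (suc d) (λ i → p i * q (d ∸ i)) + sumTo (suc d) (λ i → r i * q (d ∸ i))
      ≡⟨ sym (cong₂ _+_ (*P-sumTo p q d) (*P-sumTo r q d)) ⟩
    ((p *P q) +P (r *P q)) d ∎
    where open ≡-Reasoning

*P-identityˡ : (q : Poly) → (1P *P q) ≈P q
*P-identityˡ q d = begin
  (1P *P q) d                    ≡⟨ *P-sumTo 1P q d ⟩
  1 * q d + sumTo d (λ _ → 0)    ≡⟨ cong₂ _+_ (*-identityˡ (q d)) (sumTo-zero d (λ _ _ → refl)) ⟩
  q d + 0                        ≡⟨ +-identityʳ (q d) ⟩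
  q d                            ∎
  where open ≡-Reasoning

suc∸ : {d i : ℕ} → i < suc d → suc d ∸ i ≡ suc (d ∸ i)
suc∸ i<1+d = +-∸-assoc 1 (s≤s⁻¹ i<1+d)

*P-identityʳ : (p : Poly) → (p *P 1P) ≈P p
*P-identityʳ p d = begin
  (p *P 1P) d                                         ≡⟨ *P-sumTo p 1P d ⟩
  sumTo (suc d) (λ i → p i * 1P (d ∸ i))              ≡⟨ sumTo-last d (λ i → p i * 1P (d ∸ i)) ⟩
  sumTo d (λ i → p i * 1P (d ∸ i)) + p d * 1P (d ∸ d) ≡⟨ cong₂ _+_ (sumTo-zero d off-diagonal)
                                                                   (cong (λ z → p d * 1P z) (n∸n≡0 d)) ⟩
  0 + p d * 1                                         ≡⟨ *-identityʳ (p d) ⟩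
  p d                                                 ∎
  where
  open ≡-Reasoning
  off-diagonal : ∀ i → i < d → p i * 1P (d ∸ i) ≡ 0
  off-diagonal i (s≤s i≤d′) = trans (cong (λ z → p i * 1P z) (suc∸ (s≤s i≤d′))) (*-zeroʳ (p i))

xP-*P : (p q : Poly) → (xP p *P q) ≈P xP (p *P q)
xP-*P p q zero    = *P-sumTo (xP p) q 0
xP-*P p q (suc d) = trans (*P-sumTo (xP p) q (suc d)) (sym (*P-sumTo p q d))

xIf-*P : (b : Bool) (p q : Poly) → (xIf b p *P q) ≈P xIf b (p *P q)
xIf-*P true  = xP-*P
xIf-*P false p q = ≈P-refl

*P-xP : (p q : Poly) → (p *P xP q) ≈P xP (p *P q)
*P-xP p q zero    = trans (*P-sumTo p (xP q) 0) (trans (+-identityʳ _) (*-zeroʳ (p 0)))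
*P-xP p q (suc d) = begin
  (p *P xP q) (suc d)
    ≡⟨ *P-sumTo p (xP q) (suc d) ⟩
  sumTo (suc (suc d)) (λ i → p i * xP q (suc d ∸ i))
    ≡⟨ sumTo-last (suc d) (λ i → p i * xP q (suc d ∸ i)) ⟩
  sumTo (suc d) (λ i → p i * xP q (suc d ∸ i)) + p (suc d) * xP q (suc d ∸ suc d)
    ≡⟨ cong₂ _+_ (sumTo-cong-< (suc d) (λ i i<1+d → cong (λ z → p i * xP q z) (suc∸ i<1+d)))
                 (cong (λ z → p (suc d) * xP q z) (n∸n≡0 d)) ⟩
  sumTo (suc d) (λ i → p i * q (d ∸ i)) + p (suc d) * 0
    ≡⟨ trans (cong (sumTo (suc d) (λ i → p i * q (d ∸ i)) +_) (*-zeroʳ (p (suc d)))) (+-identityʳ _) ⟩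
  sumTo (suc d) (λ i → p i * q (d ∸ i))
    ≡⟨ sym (*P-sumTo p q d) ⟩
  (p *P q) d ∎
  where open ≡-Reasoning

-- Arrangements of distinct letters, graded by descents

⟦_⟧ : Bool → ℕ
⟦ b ⟧ = if b then 1 else 0

-- nothing encodes the absence of a predecessor
descentAfter : ℤ → Maybe ℤ → Bool
descentAfter a nothing  = false
descentAfter a (just p) = does (a ℤ.<? p)

desFrom : Maybe ℤ → List ℤ → ℕ
desFrom p []      = 0
desFrom p (a ∷ w) = ⟦ descentAfter a p ⟧ + desFrom (just a) w

desA-∷ : (a : ℤ) (w : List ℤ) → desA (a ∷ w) ≡ desFrom (just a) w
desA-∷ a []      = refl
desA-∷ a (b ∷ w) = cong (⟦ does (b ℤ.<? a) ⟧ +_) (desA-∷ b w)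

desA≡desFrom : (w : List ℤ) → desA w ≡ desFrom nothing w
desA≡desFrom []      = refl
desA≡desFrom (a ∷ w) = desA-∷ a w

picks : {X : Set} → List X → List (X × List X)
picks []       = []
picks (x ∷ xs) = (x , xs) ∷ map (map₂ (x ∷_)) (picks xs)

-- Arr m T p = Σ x^(des (p w)) over the arrangements w of T, when m = length T
Arr : ℕ → List ℤ → Maybe ℤ → Poly
Arr zero    T p = 1P
Arr (suc m) T p = ∑ (picks T) (λ q → xIf (descentAfter (proj₁ q) p) (Arr m (proj₂ q) (just (proj₁ q))))

infix 9 ⊕_ ⊖_
⊕_ ⊖_ : ℕ → ℤ
⊕ i = ℤ.+ suc i
⊖ i = -[1+ i ]

-- the same over the signed arrangements of the absolute values suc V
SignedArr : ℕ → List ℕ → Maybe ℤ → Poly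
SignedArr zero    V p = 1P
SignedArr (suc m) V p = ∑ (picks V) (λ q →
  xIf (descentAfter (⊕ proj₁ q) p) (SignedArr m (proj₂ q) (just (⊕ proj₁ q))) +P
  xIf (descentAfter (⊖ proj₁ q) p) (SignedArr m (proj₂ q) (just (⊖ proj₁ q))))

picks-↭ : {X : Set} {T : List X} {q : X × List X} → q ∈ picks T → T ↭ proj₁ q ∷ proj₂ q
picks-↭ {T = x ∷ xs} (here refl) = ↭-refl
picks-↭ {T = x ∷ xs} (there q∈) with ∈-map⁻ (map₂ (x ∷_)) q∈
... | (a , T′) , q′∈ , refl = ↭-trans (↭-prep x (picks-↭ q′∈)) (↭-swap x a ↭-refl)

picks-length : {X : Set} {T : List X} {q : X × List X} {m : ℕ} → q ∈ picks T → length T ≡ suc m → length (proj₂ q) ≡ m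
picks-length q∈ len = suc-injective (trans (sym (↭-length (picks-↭ q∈))) len)

picks-∈ : {X : Set} {T : List X} {q : X × List X} → q ∈ picks T → proj₁ q ∈ T
picks-∈ q∈ = ∈-resp-↭ (↭-sym (picks-↭ q∈)) (here refl)

picks-unique : {X : Set} {T : List X} {q : X × List X} → Unique T → q ∈ picks T → Unique (proj₂ q)
picks-unique {X} uT q∈ with ↭ₛ.Unique-resp-↭ (setoid X) (↭⇒↭ₛ (picks-↭ q∈)) uT
... | _ ∷ u = u

∑-picks-proj₁ : {X : Set} (T : List X) (f : X → Poly) → ∑ (picks T) (f ∘ proj₁) ≈P ∑ T f
∑-picks-proj₁ []       f = ≈P-refl
∑-picks-proj₁ (x ∷ xs) f =
  +P-congˡ (f x) (≈P-trans (∑-map (map₂ (x ∷_)) (picks xs) (f ∘ proj₁)) (∑-picks-proj₁ xs f))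

∑-picks-map : {X Y : Set} (g : X → Y) (xs : List X) (f : Y × List Y → Poly) →
  ∑ (picks (map g xs)) f ≈P ∑ (picks xs) (λ q → f (g (proj₁ q) , map g (proj₂ q)))
∑-picks-map g []       f = ≈P-refl
∑-picks-map g (x ∷ xs) f = +P-congˡ (f (g x , map g xs)) (begin
  ∑ (map (map₂ (g x ∷_)) (picks (map g xs))) f
    ≈⟨ ∑-map (map₂ (g x ∷_)) (picks (map g xs)) f ⟩
  ∑ (picks (map g xs)) (λ q → f (proj₁ q , g x ∷ proj₂ q))
    ≈⟨ ∑-picks-map g xs (λ q → f (proj₁ q , g x ∷ proj₂ q)) ⟩
  ∑ (picks xs) (λ q → f (g (proj₁ q) , g x ∷ map g (proj₂ q)))
    ≈⟨ ≈P-sym (∑-map (map₂ (x ∷_)) (picks xs) (λ q → f (g (proj₁ q) , map g (proj₂ q)))) ⟩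
  ∑ (map (map₂ (x ∷_)) (picks xs)) (λ q → f (g (proj₁ q) , map g (proj₂ q))) ∎)
  where open PolyReasoning

monomial : ℕ → Poly
monomial s d = ⟦ does (s ≟ d) ⟧

when : Bool → Poly → Poly
when b p = if b then p else 0P

when-cong : (b : Bool) {p q : Poly} → p ≈P q → when b p ≈P when b q
when-cong true  e = e
when-cong false e = ≈P-refl

xIf-when : (b c : Bool) (p : Poly) → xIf b (when c p) ≈P when c (xIf b p)
xIf-when b true  p = ≈P-refl
xIf-when b false p = 0-homo (xIf-linear b)

xIf-monomial : (b : Bool) (s : ℕ) → xIf b (monomial s) ≈P monomial (⟦ b ⟧ + s)
xIf-monomial false s d       = refl
xIf-monomial true  s zero    = refl
xIf-monomial true  s (suc d) = refl

∑-when : {X : Set} (b : Bool) (xs : List X) (f : X → Poly) → ∑ xs (λ x → when b (f x)) ≈P when b (∑ xs f)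
∑-when true  xs f = ≈P-refl
∑-when false xs f = ∑-0P xs

genPoly≈∑monomial : (stat : List ℤ → ℕ) (ws : List (List ℤ)) → genPoly stat ws ≈P ∑ ws (monomial ∘ stat)
genPoly≈∑monomial stat []       d = refl
genPoly≈∑monomial stat (w ∷ ws) d with does (stat w ≟ d)
... | true  = cong suc (genPoly≈∑monomial stat ws d)
... | false = genPoly≈∑monomial stat ws d

_∈ᵇ_ : ℕ → List ℕ → Bool
x ∈ᵇ []       = false
x ∈ᵇ (y ∷ ys) = (x ≡ᵇ y) ∨ (x ∈ᵇ ys)

uniqueᵇ : List ℕ → Bool
uniqueᵇ []       = true
uniqueᵇ (x ∷ xs) = not (x ∈ᵇ xs) ∧ uniqueᵇ xs

disjointᵇ : List ℕ → List ℕ → Bool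
disjointᵇ []       U = true
disjointᵇ (x ∷ xs) U = not (x ∈ᵇ U) ∧ disjointᵇ xs U

does-unique? : (xs : List ℕ) → does (unique? xs) ≡ uniqueᵇ xs
does-unique? []       = refl
does-unique? (x ∷ xs) = cong₂ _∧_ (fresh xs) (does-unique? xs)
  where
  fresh : (ys : List ℕ) → does (all? (λ y → ¬? (x ≟ y)) ys) ≡ not (x ∈ᵇ ys)
  fresh []       = refl
  fresh (y ∷ ys) with x ≡ᵇ y
  ... | true  = refl
  ... | false = fresh ys

≡ᵇ-sym : (x y : ℕ) → (x ≡ᵇ y) ≡ (y ≡ᵇ x)
≡ᵇ-sym zero    zero    = refl
≡ᵇ-sym zero    (suc y) = refl
≡ᵇ-sym (suc x) zero    = refl
≡ᵇ-sym (suc x) (suc y) = ≡ᵇ-sym x y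

disjointᵇ-[] : (xs : List ℕ) → disjointᵇ xs [] ≡ true
disjointᵇ-[] []       = refl
disjointᵇ-[] (x ∷ xs) = disjointᵇ-[] xs

disjointᵇ-∷ : (y : ℕ) (xs U : List ℕ) → disjointᵇ xs (y ∷ U) ≡ not (y ∈ᵇ xs) ∧ disjointᵇ xs U
disjointᵇ-∷ y []       U = refl
disjointᵇ-∷ y (x ∷ xs) U rewrite disjointᵇ-∷ y xs U | ≡ᵇ-sym x y
  with y ≡ᵇ x | x ∈ᵇ U | y ∈ᵇ xs
... | true  | _     | _ = refl
... | false | true  | b = sym (∧-zeroʳ (not b))
... | false | false | _ = refl

wordWeight : List ℕ → Maybe ℤ → List ℤ → Poly
wordWeight U p []      = 1P
wordWeight U p (a ∷ w) =
  if ∣ a ∣ ∈ᵇ U then 0P else xIf (descentAfter a p) (wordWeight (∣ a ∣ ∷ U) (just a) w)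

wordWeight≈when : (U : List ℕ) (p : Maybe ℤ) (w : List ℤ) →
  wordWeight U p w ≈P when (uniqueᵇ (map ∣_∣ w) ∧ disjointᵇ (map ∣_∣ w) U) (monomial (desFrom p w))
wordWeight≈when U p []      zero    = refl
wordWeight≈when U p []      (suc d) = refl
wordWeight≈when U p (a ∷ w) with ∣ a ∣ ∈ᵇ U
... | true  = λ d → cong (λ c → when c (monomial (desFrom p (a ∷ w))) d)
                           (sym (∧-zeroʳ (not (∣ a ∣ ∈ᵇ map ∣_∣ w) ∧ uniqueᵇ (map ∣_∣ w))))
... | false = begin
  xIf b (wordWeight (∣ a ∣ ∷ U) (just a) w)
    ≈⟨ ≈-cong (xIf-linear b) (wordWeight≈when (∣ a ∣ ∷ U) (just a) w) ⟩
  xIf b (when (uniqueᵇ ws ∧ disjointᵇ ws (∣ a ∣ ∷ U)) (monomial (desFrom (just a) w)))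
    ≈⟨ xIf-when b (uniqueᵇ ws ∧ disjointᵇ ws (∣ a ∣ ∷ U)) (monomial (desFrom (just a) w)) ⟩
  when (uniqueᵇ ws ∧ disjointᵇ ws (∣ a ∣ ∷ U)) (xIf b (monomial (desFrom (just a) w)))
    ≈⟨ when-cong (uniqueᵇ ws ∧ disjointᵇ ws (∣ a ∣ ∷ U)) (xIf-monomial b (desFrom (just a) w)) ⟩
  when (uniqueᵇ ws ∧ disjointᵇ ws (∣ a ∣ ∷ U)) (monomial (desFrom p (a ∷ w)))
    ≡⟨ cong (λ c → when c (monomial (desFrom p (a ∷ w)))) freshness ⟩
  when ((not (∣ a ∣ ∈ᵇ ws) ∧ uniqueᵇ ws) ∧ disjointᵇ ws U) (monomial (desFrom p (a ∷ w))) ∎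
  where
  open PolyReasoning
  b  = descentAfter a p
  ws = map ∣_∣ w
  freshness : uniqueᵇ ws ∧ disjointᵇ ws (∣ a ∣ ∷ U) ≡ (not (∣ a ∣ ∈ᵇ ws) ∧ uniqueᵇ ws) ∧ disjointᵇ ws U
  freshness rewrite disjointᵇ-∷ ∣ a ∣ ws U with not (∣ a ∣ ∈ᵇ ws) | uniqueᵇ ws
  ... | true  | _     = refl
  ... | false | true  = refl
  ... | false | false = refl

unique-word : (p : Maybe ℤ) (w : List ℤ) →
  when (does (unique? (map ∣_∣ w))) (monomial (desFrom p w)) ≈P wordWeight [] p w
unique-word p w = ≈P-sym (begin
  wordWeight [] p w
    ≈⟨ wordWeight≈when [] p w ⟩
  when (uniqueᵇ (map ∣_∣ w) ∧ disjointᵇ (map ∣_∣ w) []) (monomial (desFrom p w))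
    ≡⟨ cong (λ c → when (uniqueᵇ (map ∣_∣ w) ∧ c) (monomial (desFrom p w))) (disjointᵇ-[] (map ∣_∣ w)) ⟩
  when (uniqueᵇ (map ∣_∣ w) ∧ true) (monomial (desFrom p w))
    ≡⟨ cong (λ c → when c (monomial (desFrom p w))) (trans (∧-identityʳ _) (sym (does-unique? (map ∣_∣ w)))) ⟩
  when (does (unique? (map ∣_∣ w))) (monomial (desFrom p w)) ∎)
  where open PolyReasoning

wordsWeight : ℕ → List ℤ → List ℕ → Maybe ℤ → Poly
wordsWeight m al U p = ∑ (words m al) (wordWeight U p)

∑-words-suc : (m : ℕ) (al : List ℤ) (f : List ℤ → Poly) →
  ∑ (words (suc m) al) f ≈P ∑ al (λ a → ∑ (words m al) (λ w → f (a ∷ w)))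
∑-words-suc m al f = ≈P-trans (∑-concatMap (λ a → map (a ∷_) (words m al)) al f)
                              (∑-cong al (λ a → ∑-map (a ∷_) (words m al) f))

wordsWeight-suc : (m : ℕ) (al : List ℤ) (U : List ℕ) (p : Maybe ℤ) →
  wordsWeight (suc m) al U p ≈P
  ∑ al (λ a → if ∣ a ∣ ∈ᵇ U then 0P else xIf (descentAfter a p) (wordsWeight m al (∣ a ∣ ∷ U) (just a)))
wordsWeight-suc m al U p = ≈P-trans (∑-words-suc m al (wordWeight U p)) (∑-cong al first-letter)
  where
  first-letter : ∀ a → ∑ (words m al) (λ w → wordWeight U p (a ∷ w)) ≈P
    (if ∣ a ∣ ∈ᵇ U then 0P else xIf (descentAfter a p) (wordsWeight m al (∣ a ∣ ∷ U) (just a)))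
  first-letter a with ∣ a ∣ ∈ᵇ U
  ... | true  = ∑-0P (words m al)
  ... | false = ≈P-sym (∑-linear (xIf-linear (descentAfter a p)) (words m al) (wordWeight (∣ a ∣ ∷ U) (just a)))

genPoly-unique-words : (stat : List ℤ → ℕ) (p : Maybe ℤ) → (∀ w → stat w ≡ desFrom p w) →
  (m : ℕ) (al : List ℤ) →
  genPoly stat (filter (λ w → unique? (map ∣_∣ w)) (words m al)) ≈P wordsWeight m al [] p
genPoly-unique-words stat p stat≡ m al = begin
  genPoly stat (filter (λ w → unique? (map ∣_∣ w)) (words m al))
    ≈⟨ genPoly≈∑monomial stat (filter (λ w → unique? (map ∣_∣ w)) (words m al)) ⟩
  ∑ (filter (λ w → unique? (map ∣_∣ w)) (words m al)) (monomial ∘ stat)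
    ≈⟨ ∑-filter (λ w → unique? (map ∣_∣ w)) (words m al) (monomial ∘ stat) ⟩
  ∑ (words m al) (λ w → when (does (unique? (map ∣_∣ w))) (monomial (stat w)))
    ≈⟨ ∑-cong (words m al) (λ w → ≈P-trans
         (λ d → cong (λ s → when (does (unique? (map ∣_∣ w))) (monomial s) d) (stat≡ w)) (unique-word p w)) ⟩
  wordsWeight m al [] p ∎
  where open PolyReasoning

genPoly-firstLetter : (first : List ℤ → Bool) (sign : ℤ → Bool) → (∀ a w → first (a ∷ w) ≡ sign a) →
  (m : ℕ) (al : List ℤ) →
  genPoly desA (filterᵇ first (filter (λ w → unique? (map ∣_∣ w)) (words (suc m) al))) ≈P
  ∑ al (λ a → when (sign a) (wordsWeight m al (∣ a ∣ ∷ []) (just a)))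
genPoly-firstLetter first sign first≡ m al = begin
  genPoly desA (filterᵇ first (filter unique (words (suc m) al)))
    ≈⟨ genPoly≈∑monomial desA (filterᵇ first (filter unique (words (suc m) al))) ⟩
  ∑ (filterᵇ first (filter unique (words (suc m) al))) (monomial ∘ desA)
    ≈⟨ ∑-filterᵇ first (filter unique (words (suc m) al)) (monomial ∘ desA) ⟩
  ∑ (filter unique (words (suc m) al)) (λ w → when (first w) (monomial (desA w)))
    ≈⟨ ∑-filter unique (words (suc m) al) _ ⟩
  ∑ (words (suc m) al) (λ w → when (does (unique w)) (when (first w) (monomial (desA w))))
    ≈⟨ ∑-words-suc m al _ ⟩
  ∑ al (λ a → ∑ (words m al) (λ w → when (does (unique (a ∷ w))) (when (first (a ∷ w)) (monomial (desA (a ∷ w))))))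
    ≈⟨ ∑-cong al (λ a → ∑-cong (words m al) (λ w → word a w)) ⟩
  ∑ al (λ a → ∑ (words m al) (λ w → when (sign a) (wordWeight (∣ a ∣ ∷ []) (just a) w)))
    ≈⟨ ∑-cong al (λ a → ∑-when (sign a) (words m al) _) ⟩
  ∑ al (λ a → when (sign a) (wordsWeight m al (∣ a ∣ ∷ []) (just a))) ∎
  where
  open PolyReasoning
  unique = λ (w : List ℤ) → unique? (map ∣_∣ w)
  word : ∀ a w → when (does (unique (a ∷ w))) (when (first (a ∷ w)) (monomial (desA (a ∷ w)))) ≈P
                 when (sign a) (wordWeight (∣ a ∣ ∷ []) (just a) w)
  word a w rewrite first≡ a w | desA≡desFrom (a ∷ w) with sign a
  ... | true  = unique-word nothing (a ∷ w)
  ... | false with does (unique (a ∷ w))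
  ...   | true  = ≈P-refl
  ...   | false = ≈P-refl

remove : ℕ → List ℕ → List ℕ
remove i = filterᵇ (λ j → not (j ≡ᵇ i))

-- the indices i < n whose letters ±(i+1) are not in U
unused : ℕ → List ℕ → List ℕ
unused n U = filterᵇ (λ i → not (suc i ∈ᵇ U)) (upTo n)

filterᵇ-cong : {X : Set} {b c : X → Bool} → (∀ x → b x ≡ c x) → (xs : List X) → filterᵇ b xs ≡ filterᵇ c xs
filterᵇ-cong {b = b} {c} b≡c [] = refl
filterᵇ-cong {b = b} {c} b≡c (x ∷ xs) with b x | c x | b≡c x
... | true  | true  | _ = cong (x ∷_) (filterᵇ-cong b≡c xs)
... | false | false | _ = filterᵇ-cong b≡c xs

filterᵇ-filterᵇ : {X : Set} (b c : X → Bool) (xs : List X) →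
  filterᵇ c (filterᵇ b xs) ≡ filterᵇ (λ x → b x ∧ c x) xs
filterᵇ-filterᵇ b c [] = refl
filterᵇ-filterᵇ b c (x ∷ xs) with b x
... | false = filterᵇ-filterᵇ b c xs
... | true with c x
...   | true  = cong (x ∷_) (filterᵇ-filterᵇ b c xs)
...   | false = filterᵇ-filterᵇ b c xs

unused-∷ : (n i : ℕ) (U : List ℕ) → unused n (suc i ∷ U) ≡ remove i (unused n U)
unused-∷ n i U = trans (filterᵇ-cong de-Morgan (upTo n)) (sym (filterᵇ-filterᵇ _ _ (upTo n)))
  where
  de-Morgan : ∀ j → not ((j ≡ᵇ i) ∨ (suc j ∈ᵇ U)) ≡ not (suc j ∈ᵇ U) ∧ not (j ≡ᵇ i)
  de-Morgan j with j ≡ᵇ i | suc j ∈ᵇ U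
  ... | true  | true  = refl
  ... | true  | false = refl
  ... | false | _     = sym (∧-identityʳ _)

unused-[] : (n : ℕ) → unused n [] ≡ upTo n
unused-[] n = go (upTo n)
  where
  go : (xs : List ℕ) → filterᵇ (λ i → not (suc i ∈ᵇ [])) xs ≡ xs
  go []       = refl
  go (x ∷ xs) = cong (x ∷_) (go xs)

unused-unique : (n : ℕ) (U : List ℕ) → Unique (unused n U)
unused-unique n U = Unique.filter⁺ (T? ∘ (λ i → not (suc i ∈ᵇ U))) (Unique.upTo⁺ n)

≢⇒≡ᵇ-false : {x y : ℕ} → x ≢ y → (x ≡ᵇ y) ≡ false
≢⇒≡ᵇ-false {x} {y} x≢y with x ≡ᵇ y in eq
... | true  = ⊥-elim (x≢y (≡ᵇ⇒≡ x y (subst T (sym eq) _)))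
... | false = refl

≡ᵇ-refl : (x : ℕ) → (x ≡ᵇ x) ≡ true
≡ᵇ-refl zero    = refl
≡ᵇ-refl (suc x) = ≡ᵇ-refl x

remove-∉ : {x : ℕ} {xs : List ℕ} → All (x ≢_) xs → remove x xs ≡ xs
remove-∉ []                       = refl
remove-∉ {x} (_∷_ {y} x≢y x∉ys)
  rewrite ≡ᵇ-sym y x | ≢⇒≡ᵇ-false x≢y = cong (y ∷_) (remove-∉ x∉ys)

remove-head : {x : ℕ} {xs : List ℕ} → All (x ≢_) xs → remove x (x ∷ xs) ≡ xs
remove-head {x} x∉xs rewrite ≡ᵇ-refl x = remove-∉ x∉xs

remove-∷ : {x y : ℕ} (xs : List ℕ) → x ≢ y → remove y (x ∷ xs) ≡ x ∷ remove y xs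
remove-∷ xs x≢y rewrite ≢⇒≡ᵇ-false x≢y = refl

length-remove : {v : ℕ} {V : List ℕ} → Unique V → v ∈ V → suc (length (remove v V)) ≡ length V
length-remove (x∉xs ∷ _) (here refl) = cong suc (cong length (remove-head x∉xs))
length-remove {v} {x ∷ xs} (x∉xs ∷ uxs) (there v∈xs)
  rewrite remove-∷ xs (All.lookup x∉xs v∈xs) = cong suc (length-remove uxs v∈xs)

∑-picks-unique : {V : List ℕ} → Unique V → (f : ℕ → List ℕ → Poly) →
  ∑ (picks V) (λ q → f (proj₁ q) (proj₂ q)) ≈P ∑ V (λ v → f v (remove v V))
∑-picks-unique {[]}     []           f = ≈P-refl
∑-picks-unique {x ∷ xs} (x∉xs ∷ uxs) f =
  +P-cong (λ d → cong (λ ys → f x ys d) (sym (remove-head x∉xs))) (begin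
    ∑ (map (map₂ (x ∷_)) (picks xs)) (λ q → f (proj₁ q) (proj₂ q))
      ≈⟨ ∑-map (map₂ (x ∷_)) (picks xs) (λ q → f (proj₁ q) (proj₂ q)) ⟩
    ∑ (picks xs) (λ q → f (proj₁ q) (x ∷ proj₂ q))
      ≈⟨ ∑-picks-unique uxs (λ v W → f v (x ∷ W)) ⟩
    ∑ xs (λ v → f v (x ∷ remove v xs))
      ≈⟨ ∑-cong-∈ xs (λ v v∈xs d → cong (λ ys → f v ys d) (sym (remove-∷ xs (All.lookup x∉xs v∈xs)))) ⟩
    ∑ xs (λ v → f v (remove v (x ∷ xs))) ∎)
  where open PolyReasoning

pos≡ : (n : ℕ) → pos n ≡ map ⊕_ (upTo n)
pos≡ n = sym (map-upTo ⊕_ n)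

signed≡ : (n : ℕ) → signed n ≡ map ⊕_ (upTo n) ++ map ⊖_ (upTo n)
signed≡ n rewrite pos≡ n = cong (map ⊕_ (upTo n) ++_) (negate (upTo n))
  where
  negate : (xs : List ℕ) → map ℤ.-_ (map ⊕_ xs) ≡ map ⊖_ xs
  negate []       = refl
  negate (x ∷ xs) = cong (⊖ x ∷_) (negate xs)

∑-unused : (ℓ : ℕ → ℤ) → (∀ i → ∣ ℓ i ∣ ≡ suc i) → (n : ℕ) (U : List ℕ) (F : ℤ → Poly) →
  ∑ (map ℓ (upTo n)) (λ a → if ∣ a ∣ ∈ᵇ U then 0P else F a) ≈P ∑ (unused n U) (F ∘ ℓ)
∑-unused ℓ ∣ℓ∣ n U F = begin
  ∑ (map ℓ (upTo n)) (λ a → if ∣ a ∣ ∈ᵇ U then 0P else F a)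
    ≈⟨ ∑-map ℓ (upTo n) _ ⟩
  ∑ (upTo n) (λ i → if ∣ ℓ i ∣ ∈ᵇ U then 0P else F (ℓ i))
    ≈⟨ ∑-cong (upTo n) skip-used ⟩
  ∑ (upTo n) (λ i → if not (suc i ∈ᵇ U) then F (ℓ i) else 0P)
    ≈⟨ ≈P-sym (∑-filterᵇ (λ i → not (suc i ∈ᵇ U)) (upTo n) (F ∘ ℓ)) ⟩
  ∑ (unused n U) (F ∘ ℓ) ∎
  where
  open PolyReasoning
  skip-used : ∀ i → (if ∣ ℓ i ∣ ∈ᵇ U then 0P else F (ℓ i)) ≈P (if not (suc i ∈ᵇ U) then F (ℓ i) else 0P)
  skip-used i rewrite ∣ℓ∣ i with suc i ∈ᵇ U
  ... | true  = ≈P-refl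
  ... | false = ≈P-refl

length-unused-∷ : (n i : ℕ) (U : List ℕ) {m : ℕ} → length (unused n U) ≡ suc m → i ∈ unused n U →
  length (unused n (suc i ∷ U)) ≡ m
length-unused-∷ n i U len i∈V = suc-injective (begin
  suc (length (unused n (suc i ∷ U))) ≡⟨ cong (suc ∘ length) (unused-∷ n i U) ⟩
  suc (length (remove i (unused n U))) ≡⟨ length-remove (unused-unique n U) i∈V ⟩
  length (unused n U)                  ≡⟨ len ⟩
  suc _                                ∎)
  where open ≡-Reasoning

wordsWeight-pos : (n m : ℕ) (U : List ℕ) (p : Maybe ℤ) → length (unused n U) ≡ m →
  wordsWeight m (pos n) U p ≈P Arr m (map ⊕_ (unused n U)) p
wordsWeight-pos n zero    U p _   = +P-identityʳ 1P
wordsWeight-pos n (suc m) U p len = begin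
  wordsWeight (suc m) (pos n) U p
    ≈⟨ wordsWeight-suc m (pos n) U p ⟩
  ∑ (pos n) H
    ≡⟨ cong (λ al → ∑ al H) (pos≡ n) ⟩
  ∑ (map ⊕_ (upTo n)) H
    ≈⟨ ∑-unused ⊕_ (λ _ → refl) n U F ⟩
  ∑ V (F ∘ ⊕_)
    ≈⟨ ∑-cong-∈ V (λ i i∈V → ≈-cong (xIf-linear (descentAfter (⊕ i) p)) (rest i i∈V)) ⟩
  ∑ V (λ i → G i (remove i V))
    ≈⟨ ≈P-sym (∑-picks-unique (unused-unique n U) G) ⟩
  ∑ (picks V) (λ q → G (proj₁ q) (proj₂ q))
    ≈⟨ ≈P-sym (∑-picks-map ⊕_ V (λ q → xIf (descentAfter (proj₁ q) p) (Arr m (proj₂ q) (just (proj₁ q))))) ⟩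
  Arr (suc m) (map ⊕_ V) p ∎
  where
  open PolyReasoning
  V = unused n U
  F : ℤ → Poly
  F a = xIf (descentAfter a p) (wordsWeight m (pos n) (∣ a ∣ ∷ U) (just a))
  H : ℤ → Poly
  H a = if ∣ a ∣ ∈ᵇ U then 0P else F a
  G : ℕ → List ℕ → Poly
  G i W = xIf (descentAfter (⊕ i) p) (Arr m (map ⊕_ W) (just (⊕ i)))
  rest : ∀ i → i ∈ V → wordsWeight m (pos n) (suc i ∷ U) (just (⊕ i)) ≈P Arr m (map ⊕_ (remove i V)) (just (⊕ i))
  rest i i∈V = ≈P-trans (wordsWeight-pos n m (suc i ∷ U) (just (⊕ i)) (length-unused-∷ n i U len i∈V))
                        (λ d → cong (λ W → Arr m (map ⊕_ W) (just (⊕ i)) d) (unused-∷ n i U))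

wordsWeight-signed : (n m : ℕ) (U : List ℕ) (p : Maybe ℤ) → length (unused n U) ≡ m →
  wordsWeight m (signed n) U p ≈P SignedArr m (unused n U) p
wordsWeight-signed n zero    U p _   = +P-identityʳ 1P
wordsWeight-signed n (suc m) U p len = begin
  wordsWeight (suc m) (signed n) U p
    ≈⟨ wordsWeight-suc m (signed n) U p ⟩
  ∑ (signed n) H
    ≡⟨ cong (λ al → ∑ al H) (signed≡ n) ⟩
  ∑ (map ⊕_ (upTo n) ++ map ⊖_ (upTo n)) H
    ≈⟨ ∑-++ (map ⊕_ (upTo n)) (map ⊖_ (upTo n)) H ⟩
  ∑ (map ⊕_ (upTo n)) H +P ∑ (map ⊖_ (upTo n)) H
    ≈⟨ +P-cong (∑-unused ⊕_ (λ _ → refl) n U F) (∑-unused ⊖_ (λ _ → refl) n U F) ⟩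
  ∑ V (F ∘ ⊕_) +P ∑ V (F ∘ ⊖_)
    ≈⟨ ≈P-sym (∑-+P V (F ∘ ⊕_) (F ∘ ⊖_)) ⟩
  ∑ V (λ i → F (⊕ i) +P F (⊖ i))
    ≈⟨ ∑-cong-∈ V (λ i i∈V → +P-cong (≈-cong (xIf-linear (descentAfter (⊕ i) p)) (rest i i∈V (⊕ i)))
                                      (≈-cong (xIf-linear (descentAfter (⊖ i) p)) (rest i i∈V (⊖ i)))) ⟩
  ∑ V (λ i → G i (remove i V))
    ≈⟨ ≈P-sym (∑-picks-unique (unused-unique n U) G) ⟩
  SignedArr (suc m) V p ∎
  where
  open PolyReasoning
  V = unused n U
  F : ℤ → Poly
  F a = xIf (descentAfter a p) (wordsWeight m (signed n) (∣ a ∣ ∷ U) (just a))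
  H : ℤ → Poly
  H a = if ∣ a ∣ ∈ᵇ U then 0P else F a
  G : ℕ → List ℕ → Poly
  G i W = xIf (descentAfter (⊕ i) p) (SignedArr m W (just (⊕ i))) +P
          xIf (descentAfter (⊖ i) p) (SignedArr m W (just (⊖ i)))
  rest : ∀ i → i ∈ V → (a : ℤ) → wordsWeight m (signed n) (suc i ∷ U) (just a) ≈P SignedArr m (remove i V) (just a)
  rest i i∈V a = ≈P-trans (wordsWeight-signed n m (suc i ∷ U) (just a) (length-unused-∷ n i U len i∈V))
                          (λ d → cong (λ W → SignedArr m W (just a) d) (unused-∷ n i U))

length-unused-[] : (n : ℕ) → length (unused n []) ≡ n
length-unused-[] n = trans (cong length (unused-[] n)) (length-upTo n)

A≈Arr : (n : ℕ) → A n ≈P Arr n (map ⊕_ (upTo n)) nothing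
A≈Arr n = begin
  A n                                  ≈⟨ genPoly-unique-words desA nothing desA≡desFrom n (pos n) ⟩
  wordsWeight n (pos n) [] nothing     ≈⟨ wordsWeight-pos n n [] nothing (length-unused-[] n) ⟩
  Arr n (map ⊕_ (unused n [])) nothing ≡⟨ cong (λ V → Arr n (map ⊕_ V) nothing) (unused-[] n) ⟩
  Arr n (map ⊕_ (upTo n)) nothing      ∎
  where open PolyReasoning

B≈SignedArr : (n : ℕ) → B n ≈P SignedArr n (upTo n) (just (ℤ.+ 0))
B≈SignedArr n = begin
  B n                                         ≈⟨ genPoly-unique-words desB (just (ℤ.+ 0)) (desA-∷ (ℤ.+ 0)) n (signed n) ⟩
  wordsWeight n (signed n) [] (just (ℤ.+ 0))  ≈⟨ wordsWeight-signed n n [] (just (ℤ.+ 0)) (length-unused-[] n) ⟩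
  SignedArr n (unused n []) (just (ℤ.+ 0))    ≡⟨ cong (λ V → SignedArr n V (just (ℤ.+ 0))) (unused-[] n) ⟩
  SignedArr n (upTo n) (just (ℤ.+ 0))         ∎
  where open PolyReasoning

∑-firstLetter : (sign : ℤ → Bool) (m : ℕ) →
  ∑ (signed (suc m)) (λ a → when (sign a) (wordsWeight m (signed (suc m)) (∣ a ∣ ∷ []) (just a))) ≈P
  ∑ (picks (upTo (suc m))) (λ q → when (sign (⊕ proj₁ q)) (SignedArr m (proj₂ q) (just (⊕ proj₁ q))) +P
                                  when (sign (⊖ proj₁ q)) (SignedArr m (proj₂ q) (just (⊖ proj₁ q))))
∑-firstLetter sign m = begin
  ∑ (signed (suc m)) H
    ≡⟨ cong (λ al → ∑ al H) (signed≡ (suc m)) ⟩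
  ∑ (map ⊕_ U ++ map ⊖_ U) H
    ≈⟨ ∑-++ (map ⊕_ U) (map ⊖_ U) H ⟩
  ∑ (map ⊕_ U) H +P ∑ (map ⊖_ U) H
    ≈⟨ +P-cong (∑-map ⊕_ U H) (∑-map ⊖_ U H) ⟩
  ∑ U (H ∘ ⊕_) +P ∑ U (H ∘ ⊖_)
    ≈⟨ ≈P-sym (∑-+P U (H ∘ ⊕_) (H ∘ ⊖_)) ⟩
  ∑ U (λ i → H (⊕ i) +P H (⊖ i))
    ≈⟨ ∑-cong-∈ U (λ i i∈U → +P-cong (when-cong (sign (⊕ i)) (rest i i∈U (⊕ i)))
                                      (when-cong (sign (⊖ i)) (rest i i∈U (⊖ i)))) ⟩
  ∑ U (λ i → G i (remove i U))
    ≈⟨ ≈P-sym (∑-picks-unique (Unique.upTo⁺ (suc m)) G) ⟩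
  ∑ (picks U) (λ q → G (proj₁ q) (proj₂ q)) ∎
  where
  open PolyReasoning
  U = upTo (suc m)
  H : ℤ → Poly
  H a = when (sign a) (wordsWeight m (signed (suc m)) (∣ a ∣ ∷ []) (just a))
  G : ℕ → List ℕ → Poly
  G i W = when (sign (⊕ i)) (SignedArr m W (just (⊕ i))) +P when (sign (⊖ i)) (SignedArr m W (just (⊖ i)))
  unused≡ : (i : ℕ) → unused (suc m) (suc i ∷ []) ≡ remove i U
  unused≡ i = trans (unused-∷ (suc m) i []) (cong (remove i) (unused-[] (suc m)))
  rest : ∀ i → i ∈ U → (a : ℤ) →
    wordsWeight m (signed (suc m)) (suc i ∷ []) (just a) ≈P SignedArr m (remove i U) (just a)
  rest i i∈U a = ≈P-trans
    (wordsWeight-signed (suc m) m (suc i ∷ []) (just a) (length-unused-∷ (suc m) i [] (length-unused-[] (suc m))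
                                                          (subst (i ∈_) (sym (unused-[] (suc m))) i∈U)))
    (λ d → cong (λ W → SignedArr m W (just a) d) (unused≡ i))

CE-suc≈ : (m : ℕ) → CE (suc m) ≈P ∑ (picks (upTo (suc m))) (λ q → SignedArr m (proj₂ q) (just (⊕ proj₁ q)))
CE-suc≈ m = begin
  CE (suc m)
    ≈⟨ genPoly-firstLetter firstPos (λ a → does (ℤ.+ 0 ℤ.<? a)) (λ _ _ → refl) m (signed (suc m)) ⟩
  ∑ (signed (suc m)) (λ a → when (does (ℤ.+ 0 ℤ.<? a)) (wordsWeight m (signed (suc m)) (∣ a ∣ ∷ []) (just a)))
    ≈⟨ ∑-firstLetter (λ a → does (ℤ.+ 0 ℤ.<? a)) m ⟩
  ∑ (picks (upTo (suc m))) (λ q → SignedArr m (proj₂ q) (just (⊕ proj₁ q)) +P 0P)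
    ≈⟨ ∑-cong (picks (upTo (suc m))) (λ q → +P-identityʳ (SignedArr m (proj₂ q) (just (⊕ proj₁ q)))) ⟩
  ∑ (picks (upTo (suc m))) (λ q → SignedArr m (proj₂ q) (just (⊕ proj₁ q))) ∎
  where open PolyReasoning

CO-suc≈ : (m : ℕ) → CO (suc m) ≈P ∑ (picks (upTo (suc m))) (λ q → SignedArr m (proj₂ q) (just (⊖ proj₁ q)))
CO-suc≈ m = begin
  CO (suc m)
    ≈⟨ genPoly-firstLetter firstNeg (λ a → does (a ℤ.<? ℤ.+ 0)) (λ _ _ → refl) m (signed (suc m)) ⟩
  ∑ (signed (suc m)) (λ a → when (does (a ℤ.<? ℤ.+ 0)) (wordsWeight m (signed (suc m)) (∣ a ∣ ∷ []) (just a)))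
    ≈⟨ ∑-firstLetter (λ a → does (a ℤ.<? ℤ.+ 0)) m ⟩
  ∑ (picks (upTo (suc m))) (λ q → SignedArr m (proj₂ q) (just (⊖ proj₁ q))) ∎
  where open PolyReasoning

-- Ranks

rank : ℤ → List ℤ → ℕ
rank x T = sum (map (λ b → ⟦ does (b ℤ.<? x) ⟧) T)

rankAfter : Maybe ℤ → List ℤ → ℕ
rankAfter nothing  T = 0
rankAfter (just p) T = rank p T

rank-↭ : (x : ℤ) {T T′ : List ℤ} → T ↭ T′ → rank x T ≡ rank x T′
rank-↭ x T↭T′ = sum-↭ (↭.map⁺ (λ b → ⟦ does (b ℤ.<? x) ⟧) T↭T′)

rank-picks : (x : ℤ) {T : List ℤ} {q : ℤ × List ℤ} → q ∈ picks T →
  rank x T ≡ ⟦ does (proj₁ q ℤ.<? x) ⟧ + rank x (proj₂ q)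
rank-picks x q∈ = rank-↭ x (picks-↭ q∈)

rank-++ : (x : ℤ) (T T′ : List ℤ) → rank x (T ++ T′) ≡ rank x T + rank x T′
rank-++ x T T′ = trans (cong sum (map-++ _ T T′)) (sum-++ (map _ T) (map _ T′))

⟦⟧≤1 : (b : Bool) → ⟦ b ⟧ ≤ 1
⟦⟧≤1 true  = s≤s z≤n
⟦⟧≤1 false = z≤n

⟦<⟧-irrefl : (a : ℤ) → ⟦ does (a ℤ.<? a) ⟧ ≡ 0
⟦<⟧-irrefl a = cong ⟦_⟧ (dec-false (a ℤ.<? a) (ℤ.<-irrefl refl))

rank≤length : (x : ℤ) (T : List ℤ) → rank x T ≤ length T
rank≤length x []      = z≤n
rank≤length x (b ∷ T) = +-mono-≤ (⟦⟧≤1 (does (b ℤ.<? x))) (rank≤length x T)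

⟦<⟧-mono : (b : ℤ) {x y : ℤ} → x ℤ.≤ y → ⟦ does (b ℤ.<? x) ⟧ ≤ ⟦ does (b ℤ.<? y) ⟧
⟦<⟧-mono b {x} {y} x≤y with b ℤ.<? x
... | no  _   = z≤n
... | yes b<x rewrite dec-true (b ℤ.<? y) (ℤ.<-≤-trans b<x x≤y) = ≤-refl

rank-mono : {x y : ℤ} (T : List ℤ) → x ℤ.≤ y → rank x T ≤ rank y T
rank-mono []      x≤y = z≤n
rank-mono (b ∷ T) x≤y = +-mono-≤ (⟦<⟧-mono b x≤y) (rank-mono T x≤y)

rank-<-∈ : {a t : ℤ} {T : List ℤ} → a ∈ T → a ℤ.< t → rank a T < rank t T
rank-<-∈ {a} {t} {_ ∷ T} (here refl) a<t rewrite ⟦<⟧-irrefl a | dec-true (a ℤ.<? t) a<t =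
  s≤s (rank-mono T (ℤ.<⇒≤ a<t))
rank-<-∈ {a} {t} {b ∷ T} (there a∈T) a<t =
  +-mono-≤-< (⟦<⟧-mono b (ℤ.<⇒≤ a<t)) (rank-<-∈ a∈T a<t)

rank<length : {a : ℤ} {T : List ℤ} → a ∈ T → rank a T < length T
rank<length {a} {_ ∷ T} (here refl) rewrite ⟦<⟧-irrefl a = s≤s (rank≤length a T)
rank<length {a} {b ∷ T} (there a∈T) = +-mono-≤-< (⟦⟧≤1 (does (b ℤ.<? a))) (rank<length a∈T)

<ᵇ-rank : {a : ℤ} (t : ℤ) {T : List ℤ} → a ∈ T → t ≢ a → does (t ℤ.<? a) ≡ (rank t T ≤ᵇ rank a T)
<ᵇ-rank {a} t {T} a∈T t≢a with ℤ.<-cmp t a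
... | tri< t<a _ _ =
  trans (dec-true (t ℤ.<? a) t<a) (sym (dec-true (rank t T ≤? rank a T) (rank-mono T (ℤ.<⇒≤ t<a))))
... | tri≈ _ t≡a _ = ⊥-elim (t≢a t≡a)
... | tri> _ _ a<t =
  trans (dec-false (t ℤ.<? a) (ℤ.<-asym a<t)) (sym (dec-false (rank t T ≤? rank a T) (<⇒≱ (rank-<-∈ a∈T a<t))))

descentAfter-rank : {a : ℤ} (p : Maybe ℤ) {T : List ℤ} → a ∈ T → descentAfter a p ≡ (rank a T <ᵇ rankAfter p T)
descentAfter-rank         nothing  a∈T = refl
descentAfter-rank {a} (just q) {T} a∈T with a ℤ.<? q
... | yes a<q = sym (dec-true (rank a T <? rank q T) (rank-<-∈ a∈T a<q))
... | no  a≮q = sym (dec-false (rank a T <? rank q T) (≤⇒≯ (rank-mono T (ℤ.≮⇒≥ a≮q))))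

-- removing the value r from 0, …, m renumbers the values above r
ΣP-skip : (m r : ℕ) (g : ℕ → Poly) → r ≤ m → ΣP (suc m) g ≈P (g r +P ΣP m (λ j → g (j + ⟦ r ≤ᵇ j ⟧)))
ΣP-skip zero    zero g z≤n = +P-comm 0P (g 0)
ΣP-skip (suc m) r    g r≤1+m with r ≤? m
... | yes r≤m = begin
  ΣP (suc m) g +P g (suc m)                ≈⟨ +P-congʳ (g (suc m)) (ΣP-skip m r g r≤m) ⟩
  (g r +P ΣP m g′) +P g (suc m)            ≈⟨ +P-assoc (g r) (ΣP m g′) (g (suc m)) ⟩
  g r +P (ΣP m g′ +P g (suc m))            ≡⟨ cong (λ k → g r +P (ΣP m g′ +P g k)) (sym last) ⟩
  g r +P ΣP (suc m) g′                     ∎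
  where
  open PolyReasoning
  g′ = λ j → g (j + ⟦ r ≤ᵇ j ⟧)
  last : m + ⟦ r ≤ᵇ m ⟧ ≡ suc m
  last = trans (cong (λ b → m + ⟦ b ⟧) (dec-true (r ≤? m) r≤m)) (+-comm m 1)
... | no r≰m with ≤-antisym r≤1+m (≰⇒> r≰m)
...   | refl = ≈P-trans (+P-comm (ΣP (suc m) g) (g (suc m)))
                        (+P-congˡ (g (suc m)) (ΣP-cong-< (suc m) below))
  where
  below : ∀ j → j < suc m → g j ≈P g (j + ⟦ suc m ≤ᵇ j ⟧)
  below j j<1+m d = cong (λ k → g k d)
    (sym (trans (cong (λ b → j + ⟦ b ⟧) (dec-false (suc m ≤? j) (<⇒≱ j<1+m))) (+-identityʳ j)))

-- the ranks of the letters of a list of distinct letters are 0, 1, …, length − 1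
∑-rank : {T : List ℤ} → Unique T → (g : ℕ → Poly) → ∑ T (λ a → g (rank a T)) ≈P ΣP (length T) g
∑-rank {[]}    []            g = ≈P-refl
∑-rank {t ∷ T} (t∉T ∷ uniq) g = begin
  g (rank t (t ∷ T)) +P ∑ T (λ a → g (rank a (t ∷ T)))
    ≈⟨ +P-cong (λ d → cong (λ k → g k d) (cong (_+ rank t T) (⟦<⟧-irrefl t)))
               (∑-cong-∈ T (λ a a∈T d → cong (λ k → g k d) (shift a a∈T))) ⟩
  g r +P ∑ T (λ a → g′ (rank a T))
    ≈⟨ +P-congˡ (g r) (∑-rank uniq g′) ⟩
  g r +P ΣP (length T) g′
    ≈⟨ ≈P-sym (ΣP-skip (length T) r g (rank≤length t T)) ⟩
  ΣP (suc (length T)) g ∎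
  where
  open PolyReasoning
  r  = rank t T
  g′ = λ j → g (j + ⟦ r ≤ᵇ j ⟧)
  shift : ∀ a → a ∈ T → ⟦ does (t ℤ.<? a) ⟧ + rank a T ≡ rank a T + ⟦ r ≤ᵇ rank a T ⟧
  shift a a∈T = trans (cong (λ b → ⟦ b ⟧ + rank a T) (<ᵇ-rank t a∈T (All.lookup t∉T a∈T))) (+-comm _ (rank a T))

-- Standardisation

Std : ℕ → ℕ → Poly
Std zero    r = 1P
Std (suc m) r = ΣP (suc m) (λ j → xIf (j <ᵇ r) (Std m j))

Arr≈Std : (m : ℕ) {T : List ℤ} → length T ≡ m → Unique T → (p : Maybe ℤ) → Arr m T p ≈P Std m (rankAfter p T)
Arr≈Std zero            len uT p = ≈P-refl
Arr≈Std (suc m) {T} len uT p = begin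
  Arr (suc m) T p                          ≈⟨ ∑-cong-∈ (picks T) step ⟩
  ∑ (picks T) (λ q → g (rank (proj₁ q) T)) ≈⟨ ∑-picks-proj₁ T (λ a → g (rank a T)) ⟩
  ∑ T (λ a → g (rank a T))                 ≈⟨ ∑-rank uT g ⟩
  ΣP (length T) g                          ≡⟨ cong (λ k → ΣP k g) len ⟩
  Std (suc m) (rankAfter p T)              ∎
  where
  open PolyReasoning
  g = λ j → xIf (j <ᵇ rankAfter p T) (Std m j)
  step : ∀ q → q ∈ picks T →
    xIf (descentAfter (proj₁ q) p) (Arr m (proj₂ q) (just (proj₁ q))) ≈P g (rank (proj₁ q) T)
  step (a , T′) q∈ = ≈P-trans
    (≈-cong (xIf-linear (descentAfter a p)) (Arr≈Std m (picks-length q∈ len) (picks-unique uT q∈) (just a)))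
    (λ d → cong₂ (λ b k → xIf b (Std m k) d) (descentAfter-rank p (picks-∈ q∈))
                 (sym (trans (rank-picks a q∈) (cong (_+ rank a T′) (⟦<⟧-irrefl a)))))

⊕-injective : {i j : ℕ} → ⊕ i ≡ ⊕ j → i ≡ j
⊕-injective refl = refl

⊖-injective : {i j : ℕ} → ⊖ i ≡ ⊖ j → i ≡ j
⊖-injective refl = refl

A≈Std : (n : ℕ) → A n ≈P Std n 0
A≈Std n = ≈P-trans (A≈Arr n)
  (Arr≈Std n (trans (length-map ⊕_ (upTo n)) (length-upTo n)) (Unique.map⁺ ⊕-injective (Unique.upTo⁺ n)) nothing)

± : List ℕ → List ℤ
± V = map ⊕_ V ++ map ⊖_ V

±-unique : {V : List ℕ} → Unique V → Unique (± V)
±-unique uV = Unique.++⁺ (Unique.map⁺ ⊕-injective uV) (Unique.map⁺ ⊖-injective uV) disjoint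
  where
  disjoint : ∀ {a} → ¬ (a ∈ map ⊕_ _ × a ∈ map ⊖_ _)
  disjoint (a∈⊕ , a∈⊖) with ∈-map⁻ ⊕_ a∈⊕ | ∈-map⁻ ⊖_ a∈⊖
  ... | _ , _ , refl | _ , _ , ()

length-± : (V : List ℕ) → length (± V) ≡ length V + length V
length-± V = trans (length-++ (map ⊕_ V)) (cong₂ _+_ (length-map ⊕_ V) (length-map ⊖_ V))

rank-±-picks : (x : ℤ) {W : List ℕ} {q : ℕ × List ℕ} → q ∈ picks W →
  rank x (± W) ≡ (⟦ does (⊕ proj₁ q ℤ.<? x) ⟧ + ⟦ does (⊖ proj₁ q ℤ.<? x) ⟧) + rank x (± (proj₂ q))
rank-±-picks x {W} {v , W′} q∈ = begin
  rank x (± W)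
    ≡⟨ rank-++ x (map ⊕_ W) (map ⊖_ W) ⟩
  rank x (map ⊕_ W) + rank x (map ⊖_ W)
    ≡⟨ cong₂ _+_ (rank-↭ x (↭.map⁺ ⊕_ (picks-↭ q∈))) (rank-↭ x (↭.map⁺ ⊖_ (picks-↭ q∈))) ⟩
  (⟦ does (⊕ v ℤ.<? x) ⟧ + rank x (map ⊕_ W′)) + (⟦ does (⊖ v ℤ.<? x) ⟧ + rank x (map ⊖_ W′))
    ≡⟨ +-interchange ⟦ does (⊕ v ℤ.<? x) ⟧ (rank x (map ⊕_ W′)) ⟦ does (⊖ v ℤ.<? x) ⟧ (rank x (map ⊖_ W′)) ⟩
  (⟦ does (⊕ v ℤ.<? x) ⟧ + ⟦ does (⊖ v ℤ.<? x) ⟧) + (rank x (map ⊕_ W′) + rank x (map ⊖_ W′))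
    ≡⟨ cong (_ +_) (sym (rank-++ x (map ⊕_ W′) (map ⊖_ W′))) ⟩
  (⟦ does (⊕ v ℤ.<? x) ⟧ + ⟦ does (⊖ v ℤ.<? x) ⟧) + rank x (± W′) ∎
  where open ≡-Reasoning

rank-⊕-±-picks : {W : List ℕ} {q : ℕ × List ℕ} → q ∈ picks W →
  rank (⊕ proj₁ q) (± W) ≡ suc (rank (⊕ proj₁ q) (± (proj₂ q)))
rank-⊕-±-picks {q = v , W′} q∈
  rewrite rank-±-picks (⊕ v) q∈ | ⟦<⟧-irrefl (⊕ v) | dec-true (⊖ v ℤ.<? ⊕ v) ℤ.-<+ = refl

rank-⊖-±-picks : {W : List ℕ} {q : ℕ × List ℕ} → q ∈ picks W →
  rank (⊖ proj₁ q) (± W) ≡ rank (⊖ proj₁ q) (± (proj₂ q))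
rank-⊖-±-picks {q = v , W′} q∈
  rewrite rank-±-picks (⊖ v) q∈ | ⟦<⟧-irrefl (⊖ v) | dec-false (⊕ v ℤ.<? ⊖ v) (λ ()) = refl

rank-⊕-± : (v : ℕ) (W : List ℕ) → rank (⊕ v) (± W) ≡ rank (⊕ v) (map ⊕_ W) + length W
rank-⊕-± v W = trans (rank-++ (⊕ v) (map ⊕_ W) (map ⊖_ W)) (cong (rank (⊕ v) (map ⊕_ W) +_) (negatives W))
  where
  negatives : (W : List ℕ) → rank (⊕ v) (map ⊖_ W) ≡ length W
  negatives []      = refl
  negatives (u ∷ W) rewrite dec-true (⊖ u ℤ.<? ⊕ v) ℤ.-<+ = cong suc (negatives W)

rank-⊖-± : (v : ℕ) (W : List ℕ) → rank (⊖ v) (± W) ≡ rank (⊖ v) (map ⊖_ W)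
rank-⊖-± v W = trans (rank-++ (⊖ v) (map ⊕_ W) (map ⊖_ W)) (cong (_+ rank (⊖ v) (map ⊖_ W)) (positives W))
  where
  positives : (W : List ℕ) → rank (⊖ v) (map ⊕_ W) ≡ 0
  positives []      = refl
  positives (u ∷ W) rewrite dec-false (⊕ u ℤ.<? ⊖ v) (λ ()) = positives W

-- after taking out the letter of rank j among ± W, its partner of opposite sign lies below it iff j ≥ length W
SignedStd : ℕ → ℕ → Poly
SignedStd zero    r = 1P
SignedStd (suc m) r = ΣP (suc m + suc m) (λ j → xIf (j <ᵇ r) (SignedStd m (j ∸ ⟦ suc m ≤ᵇ j ⟧)))

SignedArr≈SignedStd : (m : ℕ) {W : List ℕ} → length W ≡ m → Unique W → (p : Maybe ℤ) →
  SignedArr m W p ≈P SignedStd m (rankAfter p (± W))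
SignedArr≈SignedStd zero            len uW p = ≈P-refl
SignedArr≈SignedStd (suc m) {W} len uW p = begin
  SignedArr (suc m) W p
    ≈⟨ ∑-cong-∈ (picks W) (λ q q∈ → +P-cong (step⊕ q q∈) (step⊖ q q∈)) ⟩
  ∑ (picks W) (λ q → g (rank (⊕ proj₁ q) (± W)) +P g (rank (⊖ proj₁ q) (± W)))
    ≈⟨ ∑-+P (picks W) _ _ ⟩
  ∑ (picks W) (λ q → g (rank (⊕ proj₁ q) (± W))) +P ∑ (picks W) (λ q → g (rank (⊖ proj₁ q) (± W)))
    ≈⟨ +P-cong (∑-picks-proj₁ W (λ v → g (rank (⊕ v) (± W))))
               (∑-picks-proj₁ W (λ v → g (rank (⊖ v) (± W)))) ⟩
  ∑ W (λ v → g (rank (⊕ v) (± W))) +P ∑ W (λ v → g (rank (⊖ v) (± W)))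
    ≈⟨ ≈P-sym (+P-cong (∑-map ⊕_ W (λ a → g (rank a (± W)))) (∑-map ⊖_ W (λ a → g (rank a (± W))))) ⟩
  ∑ (map ⊕_ W) (λ a → g (rank a (± W))) +P ∑ (map ⊖_ W) (λ a → g (rank a (± W)))
    ≈⟨ ≈P-sym (∑-++ (map ⊕_ W) (map ⊖_ W) (λ a → g (rank a (± W)))) ⟩
  ∑ (± W) (λ a → g (rank a (± W)))
    ≈⟨ ∑-rank (±-unique uW) g ⟩
  ΣP (length (± W)) g
    ≡⟨ cong (λ k → ΣP k g) (trans (length-± W) (cong₂ _+_ len len)) ⟩
  SignedStd (suc m) (rankAfter p (± W)) ∎
  where
  open PolyReasoning
  g = λ j → xIf (j <ᵇ rankAfter p (± W)) (SignedStd m (j ∸ ⟦ suc m ≤ᵇ j ⟧))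
  step : (q : ℕ × List ℕ) → q ∈ picks W → (a : ℤ) → a ∈ ± W →
    rank a (± (proj₂ q)) ≡ rank a (± W) ∸ ⟦ suc m ≤ᵇ rank a (± W) ⟧ →
    xIf (descentAfter a p) (SignedArr m (proj₂ q) (just a)) ≈P g (rank a (± W))
  step q q∈ a a∈ rank≡ = ≈P-trans
    (≈-cong (xIf-linear (descentAfter a p))
            (SignedArr≈SignedStd m (picks-length q∈ len) (picks-unique uW q∈) (just a)))
    (λ d → cong₂ (λ b k → xIf b (SignedStd m k) d) (descentAfter-rank p a∈) rank≡)
  step⊕ : ∀ q → q ∈ picks W →
    xIf (descentAfter (⊕ proj₁ q) p) (SignedArr m (proj₂ q) (just (⊕ proj₁ q))) ≈P g (rank (⊕ proj₁ q) (± W))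
  step⊕ (v , W′) q∈ = step (v , W′) q∈ (⊕ v) (∈-++⁺ˡ (∈-map⁺ ⊕_ (picks-∈ q∈))) above
    where
    above : rank (⊕ v) (± W′) ≡ rank (⊕ v) (± W) ∸ ⟦ suc m ≤ᵇ rank (⊕ v) (± W) ⟧
    above rewrite dec-true (suc m ≤? rank (⊕ v) (± W))
                    (subst (suc m ≤_) (sym (trans (rank-⊕-± v W) (cong (rank (⊕ v) (map ⊕_ W) +_) len))) (m≤n+m (suc m) _))
                | rank-⊕-±-picks q∈ = refl
  step⊖ : ∀ q → q ∈ picks W →
    xIf (descentAfter (⊖ proj₁ q) p) (SignedArr m (proj₂ q) (just (⊖ proj₁ q))) ≈P g (rank (⊖ proj₁ q) (± W))
  step⊖ (v , W′) q∈ = step (v , W′) q∈ (⊖ v) (∈-++⁺ʳ (map ⊕_ W) (∈-map⁺ ⊖_ (picks-∈ q∈))) below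
    where
    below : rank (⊖ v) (± W′) ≡ rank (⊖ v) (± W) ∸ ⟦ suc m ≤ᵇ rank (⊖ v) (± W) ⟧
    below rewrite dec-false (suc m ≤? rank (⊖ v) (± W))
                    (<⇒≱ (subst₂ _<_ (sym (rank-⊖-± v W)) (trans (length-map ⊖_ W) len)
                                     (rank<length (∈-map⁺ ⊖_ (picks-∈ q∈)))))
                = sym (rank-⊖-±-picks q∈)

-- Expanding the signs

signings : List ℕ → List (List ℤ)
signings []      = [] ∷ []
signings (v ∷ W) = map (⊕ v ∷_) (signings W) ++ map (⊖ v ∷_) (signings W)

length-signings : (W : List ℕ) → length (signings W) ≡ 2 ^ length W
length-signings []      = refl
length-signings (v ∷ W) = begin
  length (map (⊕ v ∷_) (signings W) ++ map (⊖ v ∷_) (signings W))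
    ≡⟨ length-++ (map (⊕ v ∷_) (signings W)) ⟩
  length (map (⊕ v ∷_) (signings W)) + length (map (⊖ v ∷_) (signings W))
    ≡⟨ cong₂ _+_ (length-map (⊕ v ∷_) (signings W)) (length-map (⊖ v ∷_) (signings W)) ⟩
  length (signings W) + length (signings W)
    ≡⟨ cong (λ k → k + k) (length-signings W) ⟩
  2 ^ length W + 2 ^ length W
    ≡⟨ cong (2 ^ length W +_) (sym (+-identityʳ (2 ^ length W))) ⟩
  2 ^ length (v ∷ W) ∎
  where open ≡-Reasoning

∣signings∣ : (W : List ℕ) {T : List ℤ} → T ∈ signings W → map ∣_∣ T ≡ map suc W
∣signings∣ []      (here refl) = refl
∣signings∣ (v ∷ W) T∈ with ∈-++⁻ (map (⊕ v ∷_) (signings W)) T∈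
... | inj₁ T∈⊕ with ∈-map⁻ (⊕ v ∷_) T∈⊕
...   | _ , T′∈ , refl = cong (suc v ∷_) (∣signings∣ W T′∈)
∣signings∣ (v ∷ W) T∈ | inj₂ T∈⊖ with ∈-map⁻ (⊖ v ∷_) T∈⊖
...   | _ , T′∈ , refl = cong (suc v ∷_) (∣signings∣ W T′∈)

length-∈signings : (W : List ℕ) {T : List ℤ} → T ∈ signings W → length T ≡ length W
length-∈signings W {T} T∈ = begin
  length T           ≡⟨ sym (length-map ∣_∣ T) ⟩
  length (map ∣_∣ T) ≡⟨ cong length (∣signings∣ W T∈) ⟩
  length (map suc W) ≡⟨ length-map suc W ⟩
  length W           ∎
  where open ≡-Reasoning

unique-∈signings : {W : List ℕ} {T : List ℤ} → Unique W → T ∈ signings W → Unique T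
unique-∈signings {W} uW T∈ = Unique.map⁻ (subst Unique (sym (∣signings∣ W T∈)) (Unique.map⁺ suc-injective uW))

-- a signing of W with a chosen letter = a chosen letter of W, its sign, and a signing of the rest
∑-signings-picks : (W : List ℕ) (f : ℤ → List ℤ → Poly) →
  ∑ (signings W) (λ T → ∑ (picks T) (λ q → f (proj₁ q) (proj₂ q))) ≈P
  ∑ (picks W) (λ q → ∑ (signings (proj₂ q)) (λ T → f (⊕ proj₁ q) T +P f (⊖ proj₁ q) T))
∑-signings-picks []      f = ≈P-refl
∑-signings-picks (v ∷ W) f = begin
  ∑ (map (⊕ v ∷_) S ++ map (⊖ v ∷_) S) Φ
    ≈⟨ ∑-++ (map (⊕ v ∷_) S) (map (⊖ v ∷_) S) Φ ⟩
  ∑ (map (⊕ v ∷_) S) Φ +P ∑ (map (⊖ v ∷_) S) Φ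
    ≈⟨ +P-cong (≈P-trans (∑-map (⊕ v ∷_) S Φ) (∑-+P S (f (⊕ v)) (later (⊕ v))))
               (≈P-trans (∑-map (⊖ v ∷_) S Φ) (∑-+P S (f (⊖ v)) (later (⊖ v)))) ⟩
  (∑ S (f (⊕ v)) +P ∑ S (later (⊕ v))) +P (∑ S (f (⊖ v)) +P ∑ S (later (⊖ v)))
    ≈⟨ +P-interchange (∑ S (f (⊕ v))) (∑ S (later (⊕ v))) (∑ S (f (⊖ v))) (∑ S (later (⊖ v))) ⟩
  (∑ S (f (⊕ v)) +P ∑ S (f (⊖ v))) +P (∑ S (later (⊕ v)) +P ∑ S (later (⊖ v)))
    ≈⟨ +P-cong (≈P-sym (∑-+P S (f (⊕ v)) (f (⊖ v)))) (+P-cong (laterSum (⊕ v)) (laterSum (⊖ v))) ⟩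
  ∑ S (λ T → f (⊕ v) T +P f (⊖ v) T) +P
  (∑ (picks W) (λ q → ∑ (signings (proj₂ q)) (F q ∘ (⊕ v ∷_))) +P
   ∑ (picks W) (λ q → ∑ (signings (proj₂ q)) (F q ∘ (⊖ v ∷_))))
    ≈⟨ +P-congˡ (∑ S (λ T → f (⊕ v) T +P f (⊖ v) T)) (≈P-trans
         (≈P-sym (∑-+P (picks W) (λ q → ∑ (signings (proj₂ q)) (F q ∘ (⊕ v ∷_)))
                                 (λ q → ∑ (signings (proj₂ q)) (F q ∘ (⊖ v ∷_)))))
         (∑-cong (picks W) (λ q → ≈P-sym (signings-∷ (proj₂ q) (F q))))) ⟩
  ∑ S (λ T → f (⊕ v) T +P f (⊖ v) T) +P ∑ (picks W) (λ q → ∑ (signings (v ∷ proj₂ q)) (F q))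
    ≈⟨ +P-congˡ (∑ S (λ T → f (⊕ v) T +P f (⊖ v) T))
                (≈P-sym (∑-map (map₂ (v ∷_)) (picks W) (λ q → ∑ (signings (proj₂ q)) (F q)))) ⟩
  ∑ (picks (v ∷ W)) (λ q → ∑ (signings (proj₂ q)) (F q)) ∎
  where
  open PolyReasoning
  S = signings W
  Φ : List ℤ → Poly
  Φ T = ∑ (picks T) (λ q → f (proj₁ q) (proj₂ q))
  later : ℤ → List ℤ → Poly
  later a T = ∑ (map (map₂ (a ∷_)) (picks T)) (λ q → f (proj₁ q) (proj₂ q))
  F : ℕ × List ℕ → List ℤ → Poly
  F q T = f (⊕ proj₁ q) T +P f (⊖ proj₁ q) T
  laterSum : (a : ℤ) → ∑ S (later a) ≈P ∑ (picks W) (λ q → ∑ (signings (proj₂ q)) (F q ∘ (a ∷_)))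
  laterSum a = ≈P-trans (∑-cong S (λ T → ∑-map (map₂ (a ∷_)) (picks T) (λ q → f (proj₁ q) (proj₂ q))))
                        (∑-signings-picks W (λ b T → f b (a ∷ T)))
  signings-∷ : (W′ : List ℕ) (G : List ℤ → Poly) →
    ∑ (signings (v ∷ W′)) G ≈P (∑ (signings W′) (G ∘ (⊕ v ∷_)) +P ∑ (signings W′) (G ∘ (⊖ v ∷_)))
  signings-∷ W′ G = ≈P-trans (∑-++ (map (⊕ v ∷_) (signings W′)) (map (⊖ v ∷_) (signings W′)) G)
                             (+P-cong (∑-map (⊕ v ∷_) (signings W′) G) (∑-map (⊖ v ∷_) (signings W′) G))

SignedArr≈∑signings : (m : ℕ) {W : List ℕ} → length W ≡ m → (p : Maybe ℤ) →
  SignedArr m W p ≈P ∑ (signings W) (λ T → Arr m T p)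
SignedArr≈∑signings zero {[]} len p = ≈P-sym (+P-identityʳ 1P)
SignedArr≈∑signings (suc m) {W} len p = begin
  SignedArr (suc m) W p
    ≈⟨ ∑-cong-∈ (picks W) (λ q q∈ → +P-cong (signs q q∈ (⊕ proj₁ q)) (signs q q∈ (⊖ proj₁ q))) ⟩
  ∑ (picks W) (λ q → ∑ (signings (proj₂ q)) (f (⊕ proj₁ q)) +P ∑ (signings (proj₂ q)) (f (⊖ proj₁ q)))
    ≈⟨ ∑-cong (picks W) (λ q → ≈P-sym (∑-+P (signings (proj₂ q)) (f (⊕ proj₁ q)) (f (⊖ proj₁ q)))) ⟩
  ∑ (picks W) (λ q → ∑ (signings (proj₂ q)) (λ T → f (⊕ proj₁ q) T +P f (⊖ proj₁ q) T))
    ≈⟨ ≈P-sym (∑-signings-picks W f) ⟩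
  ∑ (signings W) (λ T → Arr (suc m) T p) ∎
  where
  open PolyReasoning
  f : ℤ → List ℤ → Poly
  f a T = xIf (descentAfter a p) (Arr m T (just a))
  signs : ∀ q → q ∈ picks W → (a : ℤ) →
    xIf (descentAfter a p) (SignedArr m (proj₂ q) (just a)) ≈P ∑ (signings (proj₂ q)) (f a)
  signs q q∈ a = ≈P-trans
    (≈-cong (xIf-linear (descentAfter a p)) (SignedArr≈∑signings m (picks-length q∈ len) (just a)))
    (∑-linear (xIf-linear (descentAfter a p)) (signings (proj₂ q)) (λ T → Arr m T (just a)))

2^n·A≈SignedArr : (n : ℕ) → ((2 ^ n) ·P A n) ≈P SignedArr n (upTo n) nothing
2^n·A≈SignedArr n = begin
  (2 ^ n) ·P A n
    ≈⟨ ≈-cong (·P-linear (2 ^ n)) (A≈Std n) ⟩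
  (2 ^ n) ·P Std n 0
    ≡⟨ cong (λ k → k ·P Std n 0) (sym (trans (length-signings U) (cong (2 ^_) (length-upTo n)))) ⟩
  length (signings U) ·P Std n 0
    ≈⟨ ≈P-sym (∑-const (signings U) (Std n 0)) ⟩
  ∑ (signings U) (λ _ → Std n 0)
    ≈⟨ ∑-cong-∈ (signings U) (λ T T∈ → ≈P-sym (Arr≈Std n (trans (length-∈signings U T∈) (length-upTo n))
                                                         (unique-∈signings (Unique.upTo⁺ n) T∈) nothing)) ⟩
  ∑ (signings U) (λ T → Arr n T nothing)
    ≈⟨ ≈P-sym (SignedArr≈∑signings n (length-upTo n) nothing) ⟩
  SignedArr n U nothing ∎
  where
  open PolyReasoning
  U = upTo n

-- Splitting off the maximal prefix of letters of one sign

splits : List ℕ → List (List ℕ × List ℕ)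
splits []      = ([] , []) ∷ []
splits (v ∷ V) = map (map₁ (v ∷_)) (splits V) ++ map (map₂ (v ∷_)) (splits V)

∑-splits-∷ : (v : ℕ) (V : List ℕ) (G : List ℕ × List ℕ → Poly) →
  ∑ (splits (v ∷ V)) G ≈P (∑ (splits V) (G ∘ map₁ (v ∷_)) +P ∑ (splits V) (G ∘ map₂ (v ∷_)))
∑-splits-∷ v V G = ≈P-trans (∑-++ (map (map₁ (v ∷_)) (splits V)) (map (map₂ (v ∷_)) (splits V)) G)
                            (+P-cong (∑-map (map₁ (v ∷_)) (splits V) G) (∑-map (map₂ (v ∷_)) (splits V) G))

splits-↭ : {V : List ℕ} {s : List ℕ × List ℕ} → s ∈ splits V → V ↭ proj₁ s ++ proj₂ s
splits-↭ {[]}    (here refl) = ↭-refl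
splits-↭ {v ∷ V} s∈ with ∈-++⁻ (map (map₁ (v ∷_)) (splits V)) s∈
... | inj₁ s∈₁ with ∈-map⁻ (map₁ (v ∷_)) s∈₁
...   | _ , s′∈ , refl = ↭-prep v (splits-↭ s′∈)
splits-↭ {v ∷ V} s∈ | inj₂ s∈₂ with ∈-map⁻ (map₂ (v ∷_)) s∈₂
...   | (K , R) , s′∈ , refl = ↭-trans (↭-prep v (splits-↭ s′∈)) (↭-sym (↭.shift v K R))

splits-unique : {V : List ℕ} {s : List ℕ × List ℕ} → Unique V → s ∈ splits V → Unique (proj₁ s) × Unique (proj₂ s)
splits-unique {s = K , R} uV s∈ = ++⁻ K (↭ₛ.Unique-resp-↭ (setoid ℕ) (↭⇒↭ₛ (splits-↭ s∈)) uV)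
  where
  ++⁻ : (K : List ℕ) {R : List ℕ} → Unique (K ++ R) → Unique K × Unique R
  ++⁻ []      u            = [] , u
  ++⁻ (k ∷ K) (k∉KR ∷ uKR) = (All.++⁻ˡ K k∉KR ∷ proj₁ (++⁻ K uKR)) , proj₂ (++⁻ K uKR)

∑-splits-null : (V : List ℕ) (F : List ℕ → Poly) → ∑ (splits V) (λ s → when (null (proj₁ s)) (F (proj₂ s))) ≈P F V
∑-splits-null []      F = +P-identityʳ (F [])
∑-splits-null (v ∷ V) F =
  ≈P-trans (∑-splits-∷ v V (λ s → when (null (proj₁ s)) (F (proj₂ s))))
           (+P-cong (∑-0P (splits V)) (∑-splits-null V (F ∘ (v ∷_))))

-- a splitting (K , R) with a chosen letter of K = a chosen letter of V and a splitting of the rest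
∑-splits-picks : (V : List ℕ) (f : ℕ → List ℕ → List ℕ → Poly) →
  ∑ (splits V) (λ s → ∑ (picks (proj₁ s)) (λ q → f (proj₁ q) (proj₂ q) (proj₂ s))) ≈P
  ∑ (picks V) (λ q → ∑ (splits (proj₂ q)) (λ s → f (proj₁ q) (proj₁ s) (proj₂ s)))
∑-splits-picks []      f = +P-identityʳ 0P
∑-splits-picks (v ∷ W) f = begin
  ∑ (splits (v ∷ W)) Ψ
    ≈⟨ ∑-splits-∷ v W Ψ ⟩
  ∑ (splits W) (Ψ ∘ map₁ (v ∷_)) +P ∑ (splits W) (Ψ ∘ map₂ (v ∷_))
    ≈⟨ +P-congʳ (∑ (splits W) (Ψ ∘ map₂ (v ∷_))) (∑-+P (splits W) (λ s → f v (proj₁ s) (proj₂ s)) moved) ⟩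
  (∑ (splits W) (λ s → f v (proj₁ s) (proj₂ s)) +P ∑ (splits W) moved) +P ∑ (splits W) (Ψ ∘ map₂ (v ∷_))
    ≈⟨ +P-assoc (∑ (splits W) (λ s → f v (proj₁ s) (proj₂ s))) (∑ (splits W) moved)
                (∑ (splits W) (Ψ ∘ map₂ (v ∷_))) ⟩
  ∑ (splits W) (λ s → f v (proj₁ s) (proj₂ s)) +P (∑ (splits W) moved +P ∑ (splits W) (Ψ ∘ map₂ (v ∷_)))
    ≈⟨ +P-congˡ (∑ (splits W) (λ s → f v (proj₁ s) (proj₂ s))) (begin
         ∑ (splits W) moved +P ∑ (splits W) (Ψ ∘ map₂ (v ∷_))
           ≈⟨ +P-cong (≈P-trans (∑-cong (splits W) (λ s → ∑-map (map₂ (v ∷_)) (picks (proj₁ s)) _))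
                                (∑-splits-picks W (λ k K R → f k (v ∷ K) R)))
                      (∑-splits-picks W (λ k K R → f k K (v ∷ R))) ⟩
         ∑ (picks W) (λ q → ∑ (splits (proj₂ q)) (F q ∘ map₁ (v ∷_))) +P
         ∑ (picks W) (λ q → ∑ (splits (proj₂ q)) (F q ∘ map₂ (v ∷_)))
           ≈⟨ ≈P-sym (∑-+P (picks W) _ _) ⟩
         ∑ (picks W) (λ q → ∑ (splits (proj₂ q)) (F q ∘ map₁ (v ∷_)) +P
                            ∑ (splits (proj₂ q)) (F q ∘ map₂ (v ∷_)))
           ≈⟨ ∑-cong (picks W) (λ q → ≈P-sym (∑-splits-∷ v (proj₂ q) (F q))) ⟩
         ∑ (picks W) (λ q → ∑ (splits (v ∷ proj₂ q)) (F q))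
           ≈⟨ ≈P-sym (∑-map (map₂ (v ∷_)) (picks W) (λ q → ∑ (splits (proj₂ q)) (F q))) ⟩
         ∑ (map (map₂ (v ∷_)) (picks W)) (λ q → ∑ (splits (proj₂ q)) (F q)) ∎) ⟩
  ∑ (picks (v ∷ W)) (λ q → ∑ (splits (proj₂ q)) (F q)) ∎
  where
  open PolyReasoning
  Ψ : List ℕ × List ℕ → Poly
  Ψ s = ∑ (picks (proj₁ s)) (λ q → f (proj₁ q) (proj₂ q) (proj₂ s))
  moved : List ℕ × List ℕ → Poly
  moved s = ∑ (map (map₂ (v ∷_)) (picks (proj₁ s))) (λ q → f (proj₁ q) (proj₂ q) (proj₂ s))
  F : ℕ × List ℕ → List ℕ × List ℕ → Poly
  F q s = f (proj₁ q) (proj₁ s) (proj₂ s)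

Arr-map-∷ : (σ : ℕ → ℤ) (K : List ℕ) (p : Maybe ℤ) → Arr (length K) (map σ K) p ≈P
  (when (null K) 1P +P ∑ (picks K) (λ q → xIf (descentAfter (σ (proj₁ q)) p)
                                         (Arr (length (proj₂ q)) (map σ (proj₂ q)) (just (σ (proj₁ q))))))
Arr-map-∷ σ []      p = ≈P-sym (+P-identityʳ 1P)
Arr-map-∷ σ (k ∷ K) p = ≈P-trans
  (∑-picks-map σ (k ∷ K) (λ q → xIf (descentAfter (proj₁ q) p) (Arr (length K) (proj₂ q) (just (proj₁ q)))))
  (∑-cong-∈ (picks (k ∷ K)) (λ q q∈ d →
    cong (λ m → xIf (descentAfter (σ (proj₁ q)) p) (Arr m (map σ (proj₂ q)) (just (σ (proj₁ q)))) d)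
         (sym (picks-length q∈ refl))))

-- x^c times the signed arrangements of R that begin with a letter τ r; 1 when R is empty
Tail : Bool → (ℕ → ℤ) → List ℕ → Poly
Tail c τ []      = 1P
Tail c τ (r ∷ R) = ∑ (picks (r ∷ R)) (λ q → xIf c (SignedArr (length R) (proj₂ q) (just (τ (proj₁ q)))))

∑-picks≈Tail : (τ : ℕ → ℤ) (c : Bool) (p : Maybe ℤ) → (∀ u → descentAfter (τ u) p ≡ c) →
  (m : ℕ) {V : List ℕ} → length V ≡ suc m →
  ∑ (picks V) (λ q → xIf (descentAfter (τ (proj₁ q)) p) (SignedArr m (proj₂ q) (just (τ (proj₁ q))))) ≈P Tail c τ V
∑-picks≈Tail τ c p τ-after m {r ∷ R} len = ∑-cong (picks (r ∷ R)) (λ q d →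
  cong₂ (λ b k → xIf b (SignedArr k (proj₂ q) (just (τ (proj₁ q)))) d) (τ-after (proj₁ q)) (suc-injective (sym len)))

-- a signed arrangement is a maximal prefix of σ-letters followed by an arrangement starting with a τ-letter
SignedArr≈∑splits : (σ τ : ℕ → ℤ) → (∀ (F : ℤ → Poly) v → (F (⊕ v) +P F (⊖ v)) ≈P (F (σ v) +P F (τ v))) →
  (c : Bool) → (∀ u v → descentAfter (τ u) (just (σ v)) ≡ c) →
  (m : ℕ) {V : List ℕ} → length V ≡ m → (p : Maybe ℤ) → (∀ u → descentAfter (τ u) p ≡ c) →
  SignedArr m V p ≈P ∑ (splits V) (λ s → Arr (length (proj₁ s)) (map σ (proj₁ s)) p *P Tail c τ (proj₂ s))
SignedArr≈∑splits σ τ signs c τ-after-σ zero {[]} len p τ-after =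
  ≈P-sym (≈P-trans (+P-identityʳ (1P *P 1P)) (*P-identityˡ 1P))
SignedArr≈∑splits σ τ signs c τ-after-σ (suc m) {V} len p τ-after = begin
  SignedArr (suc m) V p
    ≈⟨ ∑-cong (picks V) (λ q → signs (λ a → xIf (descentAfter a p) (SignedArr m (proj₂ q) (just a))) (proj₁ q)) ⟩
  ∑ (picks V) (λ q → Xσ q +P Xτ q)
    ≈⟨ ∑-+P (picks V) Xσ Xτ ⟩
  ∑ (picks V) Xσ +P ∑ (picks V) Xτ
    ≈⟨ +P-comm (∑ (picks V) Xσ) (∑ (picks V) Xτ) ⟩
  ∑ (picks V) Xτ +P ∑ (picks V) Xσ
    ≈⟨ +P-cong startsτ startsσ ⟩
  ∑ (splits V) (λ s → when (null (proj₁ s)) 1P *P Tail c τ (proj₂ s)) +P ∑ (splits V) prefixed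
    ≈⟨ ≈P-sym (∑-+P (splits V) (λ s → when (null (proj₁ s)) 1P *P Tail c τ (proj₂ s)) prefixed) ⟩
  ∑ (splits V) (λ s → (when (null (proj₁ s)) 1P *P Tail c τ (proj₂ s)) +P prefixed s)
    ≈⟨ ∑-cong (splits V) (λ s → ≈P-sym (recombine s)) ⟩
  ∑ (splits V) (λ s → Arr (length (proj₁ s)) (map σ (proj₁ s)) p *P Tail c τ (proj₂ s)) ∎
  where
  open PolyReasoning
  Xσ Xτ : ℕ × List ℕ → Poly
  Xσ q = xIf (descentAfter (σ (proj₁ q)) p) (SignedArr m (proj₂ q) (just (σ (proj₁ q))))
  Xτ q = xIf (descentAfter (τ (proj₁ q)) p) (SignedArr m (proj₂ q) (just (τ (proj₁ q))))
  f : ℕ → List ℕ → List ℕ → Poly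
  f k K R = xIf (descentAfter (σ k) p) (Arr (length K) (map σ K) (just (σ k))) *P Tail c τ R
  prefixed : List ℕ × List ℕ → Poly
  prefixed s = ∑ (picks (proj₁ s)) (λ q → f (proj₁ q) (proj₂ q) (proj₂ s))
  when-null-*P : (K : List ℕ) (E : Poly) → (when (null K) 1P *P E) ≈P when (null K) E
  when-null-*P []      E = *P-identityˡ E
  when-null-*P (k ∷ K) E = 0-homo (*P-linearˡ E)
  startsτ : ∑ (picks V) Xτ ≈P ∑ (splits V) (λ s → when (null (proj₁ s)) 1P *P Tail c τ (proj₂ s))
  startsτ = ≈P-trans (∑-picks≈Tail τ c p τ-after m {V} len) (≈P-sym (≈P-trans
    (∑-cong (splits V) (λ s → when-null-*P (proj₁ s) (Tail c τ (proj₂ s)))) (∑-splits-null V (Tail c τ))))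
  startsσ : ∑ (picks V) Xσ ≈P ∑ (splits V) prefixed
  startsσ = ≈P-trans (∑-cong-∈ (picks V) (λ q q∈ → begin
      Xσ q
        ≈⟨ ≈-cong (xIf-linear (descentAfter (σ (proj₁ q)) p))
             (SignedArr≈∑splits σ τ signs c τ-after-σ m (picks-length q∈ len)
                                (just (σ (proj₁ q))) (λ u → τ-after-σ u (proj₁ q))) ⟩
      xIf (descentAfter (σ (proj₁ q)) p) (∑ (splits (proj₂ q)) (λ s →
        Arr (length (proj₁ s)) (map σ (proj₁ s)) (just (σ (proj₁ q))) *P Tail c τ (proj₂ s)))
        ≈⟨ ∑-linear (xIf-linear (descentAfter (σ (proj₁ q)) p)) (splits (proj₂ q)) _ ⟩
      ∑ (splits (proj₂ q)) (λ s → xIf (descentAfter (σ (proj₁ q)) p)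
        (Arr (length (proj₁ s)) (map σ (proj₁ s)) (just (σ (proj₁ q))) *P Tail c τ (proj₂ s)))
        ≈⟨ ∑-cong (splits (proj₂ q)) (λ s →
             ≈P-sym (xIf-*P (descentAfter (σ (proj₁ q)) p) _ (Tail c τ (proj₂ s)))) ⟩
      ∑ (splits (proj₂ q)) (λ s → f (proj₁ q) (proj₁ s) (proj₂ s)) ∎))
    (≈P-sym (∑-splits-picks V f))
  recombine : ∀ s → (Arr (length (proj₁ s)) (map σ (proj₁ s)) p *P Tail c τ (proj₂ s)) ≈P
                    ((when (null (proj₁ s)) 1P *P Tail c τ (proj₂ s)) +P prefixed s)
  recombine (K , R) = begin
    Arr (length K) (map σ K) p *P Tail c τ R
      ≈⟨ *P-congˡ (Tail c τ R) (Arr-map-∷ σ K p) ⟩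
    (when (null K) 1P +P ∑ (picks K) (λ q → xIf (descentAfter (σ (proj₁ q)) p)
       (Arr (length (proj₂ q)) (map σ (proj₂ q)) (just (σ (proj₁ q)))))) *P Tail c τ R
      ≈⟨ +-homo (*P-linearˡ (Tail c τ R)) (when (null K) 1P) _ ⟩
    (when (null K) 1P *P Tail c τ R) +P (∑ (picks K) (λ q → xIf (descentAfter (σ (proj₁ q)) p)
       (Arr (length (proj₂ q)) (map σ (proj₂ q)) (just (σ (proj₁ q))))) *P Tail c τ R)
      ≈⟨ +P-congˡ (when (null K) 1P *P Tail c τ R) (∑-linear (*P-linearˡ (Tail c τ R)) (picks K) _) ⟩
    (when (null K) 1P *P Tail c τ R) +P prefixed (K , R) ∎

-- Collecting splittings by the sizes of their parts

∑-splits-sizes : (V : List ℕ) (F : ℕ → ℕ → Poly) →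
  ∑ (splits V) (λ s → F (length (proj₁ s)) (length (proj₂ s))) ≈P
  ΣP (suc (length V)) (λ k → (length V C k) ·P F k (length V ∸ k))
∑-splits-sizes []      F = ≈P-trans (+P-identityʳ (F 0 0)) (≈P-sym (·P-identityˡ (F 0 0)))
∑-splits-sizes (v ∷ W) F = begin
  ∑ (splits (v ∷ W)) (λ s → F (length (proj₁ s)) (length (proj₂ s)))
    ≈⟨ ∑-splits-∷ v W (λ s → F (length (proj₁ s)) (length (proj₂ s))) ⟩
  ∑ (splits W) (λ s → F (suc (length (proj₁ s))) (length (proj₂ s))) +P
  ∑ (splits W) (λ s → F (length (proj₁ s)) (suc (length (proj₂ s))))
    ≈⟨ +P-cong (∑-splits-sizes W (λ k r → F (suc k) r)) (∑-splits-sizes W (λ k r → F k (suc r))) ⟩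
  ΣP (suc n) (λ k → (n C k) ·P F (suc k) (n ∸ k)) +P ΣP (suc n) (λ k → (n C k) ·P F k (suc (n ∸ k)))
    ≈⟨ +P-congˡ (ΣP (suc n) (λ k → (n C k) ·P F (suc k) (n ∸ k))) secondPart ⟩
  ΣP (suc n) (λ k → (n C k) ·P F (suc k) (n ∸ k)) +P (h 0 +P ΣP (suc n) (h ∘ suc))
    ≈⟨ +P-leftComm (ΣP (suc n) (λ k → (n C k) ·P F (suc k) (n ∸ k))) (h 0) (ΣP (suc n) (h ∘ suc)) ⟩
  h 0 +P (ΣP (suc n) (λ k → (n C k) ·P F (suc k) (n ∸ k)) +P ΣP (suc n) (h ∘ suc))
    ≈⟨ +P-congˡ (h 0) (≈P-sym pascal) ⟩
  h 0 +P ΣP (suc n) (h′ ∘ suc)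
    ≈⟨ ≈P-sym (ΣP-suc (suc n) h′) ⟩
  ΣP (suc (suc n)) h′ ∎
  where
  open PolyReasoning
  n = length W
  h h′ : ℕ → Poly
  h  k = (n C k) ·P F k (suc n ∸ k)
  h′ k = (suc n C k) ·P F k (suc n ∸ k)
  +P-leftComm : (p q r : Poly) → (p +P (q +P r)) ≈P (q +P (p +P r))
  +P-leftComm p q r = ≈P-trans (≈P-sym (+P-assoc p q r)) (≈P-trans (+P-congʳ r (+P-comm p q)) (+P-assoc q p r))
  secondPart : ΣP (suc n) (λ k → (n C k) ·P F k (suc (n ∸ k))) ≈P (h 0 +P ΣP (suc n) (h ∘ suc))
  secondPart = begin
    ΣP (suc n) (λ k → (n C k) ·P F k (suc (n ∸ k)))
      ≈⟨ ΣP-cong-< (suc n) (λ k k<1+n d → cong (λ r → ((n C k) ·P F k r) d) (sym (suc∸ k<1+n))) ⟩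
    ΣP (suc n) h
      ≈⟨ ≈P-sym (+P-identityʳ (ΣP (suc n) h)) ⟩
    ΣP (suc n) h +P 0P
      ≈⟨ +P-congˡ (ΣP (suc n) h) (λ d → cong (λ c → (c ·P F (suc n) (suc n ∸ suc n)) d)
                                             (sym (k>n⇒nCk≡0 {n} {suc n} ≤-refl))) ⟩
    ΣP (suc (suc n)) h
      ≈⟨ ΣP-suc (suc n) h ⟩
    h 0 +P ΣP (suc n) (h ∘ suc) ∎
  pascal : ΣP (suc n) (h′ ∘ suc) ≈P (ΣP (suc n) (λ k → (n C k) ·P F (suc k) (n ∸ k)) +P ΣP (suc n) (h ∘ suc))
  pascal = ≈P-trans
    (ΣP-cong (suc n) (λ k → ≈P-trans (λ d → cong (λ c → (c ·P F (suc k) (n ∸ k)) d)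
                                                 (sym (nCk+nC[k+1]≡[n+1]C[k+1] n k)))
                                     (·P-distribʳ (n C k) (n C suc k) (F (suc k) (n ∸ k)))))
    (ΣP-+P (suc n) (λ k → (n C k) ·P F (suc k) (n ∸ k)) (h ∘ suc))

∑-picks-signed : (s : ℕ → ℤ) → (∀ {i j} → s i ≡ s j → i ≡ j) → (k : ℕ) (g : ℕ → Poly) {R : List ℕ} →
  Unique R → length R ≡ suc k →
  (∀ {q} → q ∈ picks R → SignedStd k (rank (s (proj₁ q)) (± (proj₂ q))) ≈P g (rank (s (proj₁ q)) (map s R))) →
  ∑ (picks R) (λ q → SignedArr k (proj₂ q) (just (s (proj₁ q)))) ≈P ΣP (suc k) g
∑-picks-signed s s-injective k g {R} uR len std≈g = begin
  ∑ (picks R) (λ q → SignedArr k (proj₂ q) (just (s (proj₁ q))))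
    ≈⟨ ∑-cong-∈ (picks R) (λ q q∈ → ≈P-trans
         (SignedArr≈SignedStd k (picks-length q∈ len) (picks-unique uR q∈) (just (s (proj₁ q))))
         (std≈g q∈)) ⟩
  ∑ (picks R) (λ q → g (rank (s (proj₁ q)) (map s R)))
    ≈⟨ ∑-picks-proj₁ R (λ v → g (rank (s v) (map s R))) ⟩
  ∑ R (λ v → g (rank (s v) (map s R)))
    ≈⟨ ≈P-sym (∑-map s R (λ a → g (rank a (map s R)))) ⟩
  ∑ (map s R) (λ a → g (rank a (map s R)))
    ≈⟨ ∑-rank (Unique.map⁺ s-injective uR) g ⟩
  ΣP (length (map s R)) g
    ≡⟨ cong (λ m → ΣP m g) (trans (length-map s R) len) ⟩
  ΣP (suc k) g ∎
  where open PolyReasoning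

∑-picks-⊕ : (k : ℕ) {R : List ℕ} → Unique R → length R ≡ suc k →
  ∑ (picks R) (λ q → SignedArr k (proj₂ q) (just (⊕ proj₁ q))) ≈P ΣP (suc k) (λ j → SignedStd k (j + k))
∑-picks-⊕ k {R} uR len = ∑-picks-signed ⊕_ ⊕-injective k (λ j → SignedStd k (j + k)) uR len
  (λ {q} q∈ d → cong (λ r → SignedStd k r d) (suc-injective (begin
    suc (rank (⊕ proj₁ q) (± (proj₂ q)))            ≡⟨ sym (rank-⊕-±-picks q∈) ⟩
    rank (⊕ proj₁ q) (± R)                          ≡⟨ rank-⊕-± (proj₁ q) R ⟩
    rank (⊕ proj₁ q) (map ⊕_ R) + length R          ≡⟨ cong (rank (⊕ proj₁ q) (map ⊕_ R) +_) len ⟩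
    rank (⊕ proj₁ q) (map ⊕_ R) + suc k             ≡⟨ +-suc _ k ⟩
    suc (rank (⊕ proj₁ q) (map ⊕_ R) + k)           ∎)))
  where open ≡-Reasoning

∑-picks-⊖ : (k : ℕ) {R : List ℕ} → Unique R → length R ≡ suc k →
  ∑ (picks R) (λ q → SignedArr k (proj₂ q) (just (⊖ proj₁ q))) ≈P ΣP (suc k) (SignedStd k)
∑-picks-⊖ k {R} uR len = ∑-picks-signed ⊖_ ⊖-injective k (SignedStd k) uR len
  (λ {q} q∈ d → cong (λ r → SignedStd k r d) (trans (sym (rank-⊖-±-picks q∈)) (rank-⊖-± (proj₁ q) R)))

Tail-⊕≈CE : {R : List ℕ} → Unique R → Tail false ⊕_ R ≈P CE (length R)
Tail-⊕≈CE {[]}    _  = ≈P-refl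
Tail-⊕≈CE {r ∷ R} uR = ≈P-trans (∑-picks-⊕ (length R) uR refl) (≈P-sym (≈P-trans (CE-suc≈ (length R))
  (∑-picks-⊕ (length R) (Unique.upTo⁺ (suc (length R))) (length-upTo (suc (length R))))))

xCO : ℕ → Poly
xCO zero    = 1P
xCO (suc r) = xP (CO (suc r))

Tail-⊖≈xCO : {R : List ℕ} → Unique R → Tail true ⊖_ R ≈P xCO (length R)
Tail-⊖≈xCO {[]}    _  = ≈P-refl
Tail-⊖≈xCO {r ∷ R} uR = ≈P-trans
  (≈P-sym (∑-linear xP-linear (picks (r ∷ R)) (λ q → SignedArr (length R) (proj₂ q) (just (⊖ proj₁ q)))))
  (≈-cong xP-linear (≈P-trans (∑-picks-⊖ (length R) uR refl) (≈P-sym (≈P-trans (CO-suc≈ (length R))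
    (∑-picks-⊖ (length R) (Unique.upTo⁺ (suc (length R))) (length-upTo (suc (length R))))))))

Arr-map≈A : (σ : ℕ → ℤ) → (∀ {i j} → σ i ≡ σ j → i ≡ j) → {K : List ℕ} → Unique K →
  (p : Maybe ℤ) → rankAfter p (map σ K) ≡ 0 → Arr (length K) (map σ K) p ≈P A (length K)
Arr-map≈A σ σ-injective {K} uK p rank≡0 = begin
  Arr (length K) (map σ K) p             ≈⟨ Arr≈Std (length K) (length-map σ K) (Unique.map⁺ σ-injective uK) p ⟩
  Std (length K) (rankAfter p (map σ K)) ≡⟨ cong (Std (length K)) rank≡0 ⟩
  Std (length K) 0                       ≈⟨ ≈P-sym (A≈Std (length K)) ⟩
  A (length K)                           ∎
  where open PolyReasoning

2^n·A≈∑A*CE : (n : ℕ) → ((2 ^ n) ·P A n) ≈P ΣP (suc n) (λ k → (n C k) ·P (A k *P CE (n ∸ k)))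
2^n·A≈∑A*CE n = begin
  (2 ^ n) ·P A n
    ≈⟨ 2^n·A≈SignedArr n ⟩
  SignedArr n U nothing
    ≈⟨ SignedArr≈∑splits ⊖_ ⊕_ (λ F v → +P-comm (F (⊕ v)) (F (⊖ v))) false (λ _ _ → refl)
                          n (length-upTo n) nothing (λ _ → refl) ⟩
  ∑ (splits U) (λ s → Arr (length (proj₁ s)) (map ⊖_ (proj₁ s)) nothing *P Tail false ⊕_ (proj₂ s))
    ≈⟨ ∑-cong-∈ (splits U) (λ s s∈ → let (uK , uR) = splits-unique (Unique.upTo⁺ n) s∈ in
         ≈P-trans (*P-congˡ (Tail false ⊕_ (proj₂ s)) (Arr-map≈A ⊖_ ⊖-injective uK nothing refl))
                  (*P-congʳ (A (length (proj₁ s))) (Tail-⊕≈CE uR))) ⟩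
  ∑ (splits U) (λ s → A (length (proj₁ s)) *P CE (length (proj₂ s)))
    ≈⟨ ∑-splits-sizes U (λ k r → A k *P CE r) ⟩
  ΣP (suc (length U)) (λ k → (length U C k) ·P (A k *P CE (length U ∸ k)))
    ≡⟨ cong (λ m → ΣP (suc m) (λ k → (m C k) ·P (A k *P CE (m ∸ k)))) (length-upTo n) ⟩
  ΣP (suc n) (λ k → (n C k) ·P (A k *P CE (n ∸ k))) ∎
  where
  open PolyReasoning
  U = upTo n

rank0-⊕ : (K : List ℕ) → rank (ℤ.+ 0) (map ⊕_ K) ≡ 0
rank0-⊕ []      = refl
rank0-⊕ (u ∷ K) rewrite dec-false (⊕ u ℤ.<? ℤ.+ 0) (λ { (ℤ.+<+ ()) }) = rank0-⊕ K

B≈A+x∑A*CO : (n : ℕ) → B n ≈P (A n +P xP (ΣP n (λ k → (n C k) ·P (A k *P CO (n ∸ k)))))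
B≈A+x∑A*CO n = begin
  B n
    ≈⟨ B≈SignedArr n ⟩
  SignedArr n U (just (ℤ.+ 0))
    ≈⟨ SignedArr≈∑splits ⊕_ ⊖_ (λ F v → ≈P-refl) true (λ u v → dec-true (⊖ u ℤ.<? ⊕ v) ℤ.-<+)
                          n (length-upTo n) (just (ℤ.+ 0)) (λ u → dec-true (⊖ u ℤ.<? ℤ.+ 0) ℤ.-<+) ⟩
  ∑ (splits U) (λ s → Arr (length (proj₁ s)) (map ⊕_ (proj₁ s)) (just (ℤ.+ 0)) *P Tail true ⊖_ (proj₂ s))
    ≈⟨ ∑-cong-∈ (splits U) (λ s s∈ → let (uK , uR) = splits-unique (Unique.upTo⁺ n) s∈ in
         ≈P-trans (*P-congˡ (Tail true ⊖_ (proj₂ s))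
                             (Arr-map≈A ⊕_ ⊕-injective uK (just (ℤ.+ 0)) (rank0-⊕ (proj₁ s))))
                  (*P-congʳ (A (length (proj₁ s))) (Tail-⊖≈xCO uR))) ⟩
  ∑ (splits U) (λ s → A (length (proj₁ s)) *P xCO (length (proj₂ s)))
    ≈⟨ ∑-splits-sizes U (λ k r → A k *P xCO r) ⟩
  ΣP (suc (length U)) (λ k → (length U C k) ·P (A k *P xCO (length U ∸ k)))
    ≡⟨ cong (λ m → ΣP (suc m) (λ k → (m C k) ·P (A k *P xCO (m ∸ k)))) (length-upTo n) ⟩
  ΣP n f +P f n
    ≈⟨ +P-cong (ΣP-cong-< n proper) full ⟩
  ΣP n (xP ∘ g) +P A n
    ≈⟨ +P-congʳ (A n) (≈P-sym (ΣP-linear xP-linear n g)) ⟩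
  xP (ΣP n g) +P A n
    ≈⟨ +P-comm (xP (ΣP n g)) (A n) ⟩
  A n +P xP (ΣP n g) ∎
  where
  open PolyReasoning
  U = upTo n
  f g : ℕ → Poly
  f k = (n C k) ·P (A k *P xCO (n ∸ k))
  g k = (n C k) ·P (A k *P CO (n ∸ k))
  xCO-suc : (r : ℕ) → 0 < r → xCO r ≈P xP (CO r)
  xCO-suc (suc r) _ = ≈P-refl
  proper : ∀ k → k < n → f k ≈P xP (g k)
  proper k k<n = ≈P-trans
    (≈-cong (·P-linear (n C k)) (≈P-trans (*P-congʳ (A k) (xCO-suc (n ∸ k) (m<n⇒0<n∸m k<n))) (*P-xP (A k) (CO (n ∸ k)))))
    (·P-xP (n C k) (A k *P CO (n ∸ k)))
  full : f n ≈P A n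
  full = ≈P-trans (λ d → cong₂ (λ c r → (c ·P (A n *P xCO r)) d) (nCn≡1 n) (n∸n≡0 n))
                  (≈P-trans (·P-identityˡ (A n *P 1P)) (*P-identityʳ (A n)))

corollary2p3 : (n : ℕ) →
    ((2 ^ n) ·P A n) ≈P ΣP (suc n) (λ k → (n C k) ·P (A k *P CE (n ∸ k)))
    × (B n ≈P (A n +P xP (ΣP n (λ k → (n C k) ·P (A k *P CO (n ∸ k))))))
corollary2p3 n = 2^n·A≈∑A*CE n , B≈A+x∑A*CO n
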